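{- Let $j\ge1$ be a fixed integer. For every integer $k\ge1$ and every integer $n\ge2$, $$E_{j,k}(n)\ll\frac{k\,\kappa_j(n)}{\Omega(n)},$$ where the implied constant may depend on $j$ only.
   Context: For an integer $n\ge1$, $\mathcal{D}_n$ denotes the set of positive divisors of $n$, $\Omega(n)=\sum_{p^v\| n}v$, and $\kappa_j(n)=\prod_{p^v\| n}(jv+1)$ (the number of $j$-tuples in $\mathcal{D}_n^j$ with pairwise coprime entries). A set $U\subseteq\mathcal{D}_n^j$ is called regular if every tuple in $U$ has pairwise coprime entries. For an integer $k\ge1$, a map $g:U_g\to\mathcal{D}_n$ defined on a regular set $U_g\subseteq \mathcal{D}_n^j$ is called $k$-regular if (0) for every $(d_1,\dots,d_j)\in U_g$ one has $\gcd(g(d_1,\dots,d_j),d_i)=1$ for each $i$; (1) for each $1\le i\le j$ and each fixed choice of the other coordinates and of $d$, the equation $g(d_1,\dots,d_{i-1},z,d_{i+1},\dots,d_j)=d$ has at most $k$ solutions $z$ with the tuple in $U_g$; (2) under the same fixing, the equation $z\,g(d_1,\dots,d_{i-1},z,d_{i+1},\dots,d_j)=d$ has at most $k$ solutions $z$ with the tuple in $U_g$. $E_{j,k}(n)$ is the maximum of $|U_g|$ over all $k$-regular maps $g$. -}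

module Defs where

open import Data.Nat using (ℕ; zero; suc; _+_; _*_; _≤_)
open import Data.Nat.Properties using (_≟_)
open import Data.Nat.Divisibility using (_∣_)
open import Data.Nat.Coprimality using (Coprime)
open import Data.Nat.ListAction using (product)
open import Data.Nat.Primality.Factorisation using (factorise; factors)
open import Data.List using (List; length; filter; map; deduplicate)
open import Data.List.Membership.Propositional using (_∈_)
open import Data.List.Relation.Unary.All using (All)
open import Data.List.Relation.Unary.Unique.Propositional using (Unique)
open import Data.Vec using (Vec; lookup; _[_]≔_)
open import Data.Fin using (Fin)
open import Data.Product using (_×_)
open import Relation.Binary.PropositionalEquality using (_≡_; _≢_)

-- prime factors of n with multiplicity (empty list for n = 0 and n = 1)
primeFactors : ℕ → List ℕ
primeFactors zero    = Data.List.[]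
primeFactors (suc m) = factors (factorise (suc m))

Ω : ℕ → ℕ
Ω n = length (primeFactors n)

val : ℕ → ℕ → ℕ
val p n = length (filter (_≟ p) (primeFactors n))

κ : ℕ → ℕ → ℕ
κ j n = product (map (λ p → j * val p n + 1) (deduplicate _≟_ (primeFactors n)))

Tuple : ℕ → Set
Tuple j = Vec ℕ j

RegularTuple : (n j : ℕ) → Tuple j → Set
RegularTuple n j t =
  ((i : Fin j) → lookup t i ∣ n) ×
  ((a b : Fin j) → a ≢ b → Coprime (lookup t a) (lookup t b))

RegularSet : (n j : ℕ) → List (Tuple j) → Set
RegularSet n j U = Unique U × All (RegularTuple n j) U

-- "the equation P z has at most k solutions z": every duplicate-free list of solutions has length ≤ k
AtMost : ℕ → (ℕ → Set) → Set
AtMost k P = (zs : List ℕ) → Unique zs → All P zs → length zs ≤ k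

-- g : U → D_n is k-regular (g is given as a total function; only its values on U matter)
KRegular : (n j k : ℕ) → List (Tuple j) → (Tuple j → ℕ) → Set
KRegular n j k U g =
  (∀ t → t ∈ U → g t ∣ n) ×
  (∀ t → t ∈ U → (i : Fin j) → Coprime (g t) (lookup t i)) ×
  (∀ (i : Fin j) (t : Tuple j) (d : ℕ) →
     AtMost k (λ z → ((t [ i ]≔ z) ∈ U) × (g (t [ i ]≔ z) ≡ d))) ×
  (∀ (i : Fin j) (t : Tuple j) (d : ℕ) →
     AtMost k (λ z → ((t [ i ]≔ z) ∈ U) × (z * g (t [ i ]≔ z) ≡ d)))

-- Write n = ∏ p ^ v. A regular j-tuple of n is determined by its codes at the primes p ∣ n: the code is 0 if
-- p divides no entry, and i v + a if p ^ a exactly divides the i-th entry. For t ∈ U and h = g t consider the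
-- 2 j + 1 regular tuples t[i ≔ h], t and t[i ≔ tᵢ h]; by conditions (1) and (2) each of these views is an at
-- most k-to-1 function of t ∈ U. Give each view a score Σ_p weight · [code at p = target]. Since p divides at
-- most one of t₁, …, t_j, h, the views hit their targets more often than a random regular tuple does, and the
-- deviations κ_j(n) (score − mean score) of the 2 j + 1 views add up to at least κ_j(n) Ω(n) / (2 j + 1).
-- As the codes at distinct primes are independent over the κ_j(n) regular tuples, the squared deviation of a
-- score summed over all regular tuples is at most 4 κ_j(n)³ Ω(n) / j. Cauchy–Schwarz over the views and the
-- k-to-1 property give j |U| (κ_j(n) Ω(n))² ≤ 4 (2 j + 1)⁴ k κ_j(n)³ Ω(n).

module Submission where

open import Defs
open import Data.Nat using (ℕ; z≤n; s≤s)
open import Data.Nat.Divisibility using (_∣_; _∤_; _∣?_)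
open import Data.Nat.Coprimality using (Coprime)
open import Data.Nat.Primality using (Prime; euclidsLemma)
open import Data.Nat.Primality.Factorisation using (factorise; PrimeFactorisation)
open import Data.Fin using (Fin; zero; suc; toℕ)
import Data.Fin.Properties
open import Data.Vec using (Vec; []; _∷_; lookup; map; replicate; _[_]≔_)
open import Data.Vec.Properties
  using (tabulate∘lookup; tabulate-cong; lookup-map; lookup-replicate; lookup∘update; lookup∘update′; []≔-idempotent; []≔-lookup; ≡-dec)
open import Data.List as List using (List; []; _∷_; _++_; filter; length; deduplicate; downFrom; allFin)
open import Data.List.Properties using (length-downFrom)
open import Data.List.Membership.Propositional using (_∈_; _∉_)
open import Data.List.Membership.Propositional.Properties
  using (∈-filter⁻; ∈-map⁺; ∈-map⁻; ∈-deduplicate⁺; ∈-deduplicate⁻; ∈-downFrom⁺; ∈-allFin; ∈-++⁺ˡ; ∈-++⁺ʳ)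
open import Data.List.Relation.Unary.All as All using (All; []; _∷_)
import Data.List.Relation.Unary.All.Properties as All⁺
open import Data.List.Relation.Unary.All.Properties using (All¬⇒¬Any)
open import Data.List.Relation.Unary.Any using (here; there)
open import Data.List.Relation.Unary.AllPairs using ([]; _∷_)
open import Data.List.Relation.Unary.Unique.Propositional using (Unique)
import Data.List.Relation.Unary.Unique.Propositional.Properties as Unique
open import Data.List.Relation.Unary.Unique.Propositional.Properties using (downFrom⁺)
open import Data.List.Relation.Unary.Unique.DecPropositional.Properties using (deduplicate-!)
open import Data.Product using (Σ; _×_; _,_; proj₁; proj₂)
open import Data.Sum using (_⊎_; inj₁; inj₂)
open import Data.Unit using (⊤; tt)
open import Data.Empty using (⊥; ⊥-elim)
open import Function using (_∘_)
open import Relation.Nullary using (yes; no; Dec)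
open import Relation.Binary.Definitions using (DecidableEquality)
open import Relation.Binary.PropositionalEquality

lookup⇒≡ : ∀ {A : Set} {m} (xs ys : Vec A m) → (∀ l → lookup xs l ≡ lookup ys l) → xs ≡ ys
lookup⇒≡ xs ys eq = trans (sym (tabulate∘lookup xs)) (trans (tabulate-cong eq) (tabulate∘lookup ys))

Unique-map⁺ : ∀ {A B : Set} (f : A → B) {xs : List A} → (∀ {x y} → x ∈ xs → y ∈ xs → f x ≡ f y → x ≡ y) →
              Unique xs → Unique (List.map f xs)
Unique-map⁺ f {[]}     f-inj []           = []
Unique-map⁺ f {x ∷ xs} f-inj (x∉xs ∷ xs!) =
  All⁺.map⁺ (All.tabulate (λ y∈xs fx≡fy → All.lookup x∉xs y∈xs (f-inj (here refl) (there y∈xs) fx≡fy))) ∷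
  Unique-map⁺ f (λ x∈ y∈ → f-inj (there x∈) (there y∈)) xs!

Unique-const⇒length≤1 : ∀ {A : Set} {c : A} (xs : List A) → Unique xs → All (_≡ c) xs → length xs Data.Nat.≤ 1
Unique-const⇒length≤1 []           _                 _              = z≤n
Unique-const⇒length≤1 (_ ∷ [])     _                 _              = s≤s z≤n
Unique-const⇒length≤1 (_ ∷ _ ∷ _)  ((x≢y ∷ _) ∷ _)   (x≡c ∷ y≡c ∷ _) = ⊥-elim (x≢y (trans x≡c (sym y≡c)))

module Valuation where

  open import Data.Nat
  open import Data.Nat.Properties
  open import Data.Nat.Divisibility
  open import Data.Nat.Primality
  open import Data.Nat.Coprimality using (coprime-divisor)
  open import Data.Nat.Tactic.RingSolver using (solve-∀)

  prime⇒>1 : ∀ {p} → Prime p → 1 < p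
  prime⇒>1 {p} (prime _) = nonTrivial⇒n>1 p

  private
    -- The fuel f only has to bound the number of divisions by p; d itself does.
    ord′ strip′ : ℕ → ℕ → ℕ → ℕ
    ord′ zero    p d       = 0
    ord′ (suc f) p zero    = 0
    ord′ (suc f) p (suc d) with p ∣? suc d
    ... | yes (divides q _) = suc (ord′ f p q)
    ... | no _              = 0

    strip′ zero    p d       = d
    strip′ (suc f) p zero    = zero
    strip′ (suc f) p (suc d) with p ∣? suc d
    ... | yes (divides q _) = strip′ f p q
    ... | no _              = suc d

    quotient<′ : ∀ {p q d} → 1 < p → suc d ≡ q * p → q < suc d
    quotient<′ p>1 e = quotient-< (divides _ e) {{n>1⇒nonTrivial p>1}}

    d≡p^ord′*strip′ : ∀ f {p} d → 1 < p → d ≤ f → d ≡ p ^ ord′ f p d * strip′ f p d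
    d≡p^ord′*strip′ zero    zero    p>1 d≤f = refl
    d≡p^ord′*strip′ (suc f) zero    p>1 d≤f = refl
    d≡p^ord′*strip′ (suc f) {p} (suc d) p>1 d≤f with p ∣? suc d
    ... | yes (divides q e) = begin
      suc d                   ≡⟨ e ⟩
      q * p                   ≡⟨ cong (_* p) (d≡p^ord′*strip′ f q p>1 q≤f) ⟩
      p ^ a * s * p           ≡⟨ *-comm (p ^ a * s) p ⟩
      p * (p ^ a * s)         ≡⟨ *-assoc p (p ^ a) s ⟨
      p * p ^ a * s           ∎
      where open ≡-Reasoning
            q≤f : q ≤ f
            q≤f = ≤-pred (≤-trans (quotient<′ p>1 e) d≤f)
            a = ord′ f p q
            s = strip′ f p q
    ... | no _ = sym (+-identityʳ (suc d))

    p∤strip′ : ∀ f {p} d → 1 < p → d ≤ f → d ≢ 0 → p ∤ strip′ f p d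
    p∤strip′ zero    zero    p>1 d≤f d≢0 = ⊥-elim (d≢0 refl)
    p∤strip′ (suc f) zero    p>1 d≤f d≢0 = ⊥-elim (d≢0 refl)
    p∤strip′ (suc f) {p} (suc d) p>1 d≤f d≢0 with p ∣? suc d
    ... | yes (divides q e) = p∤strip′ f q p>1 (≤-pred (≤-trans (quotient<′ p>1 e) d≤f)) q≢0
      where q≢0 : q ≢ 0
            q≢0 refl = 0≢1+n (sym e)
    ... | no p∤d = p∤d

  ord strip : ℕ → ℕ → ℕ
  ord   p d = ord′ d p d
  strip p d = strip′ d p d

  d≡p^ord*strip : ∀ {p} d → 1 < p → d ≡ p ^ ord p d * strip p d
  d≡p^ord*strip d p>1 = d≡p^ord′*strip′ d d p>1 ≤-refl

  p∤strip : ∀ {p} d → 1 < p → d ≢ 0 → p ∤ strip p d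
  p∤strip d p>1 = p∤strip′ d d p>1 ≤-refl

  strip∣ : ∀ {p} d → 1 < p → strip p d ∣ d
  strip∣ {p} d p>1 = divides (p ^ ord p d) (d≡p^ord*strip d p>1)

  >1⇒nonZero : ∀ {p} → 1 < p → NonZero p
  >1⇒nonZero p>1 = >-nonZero (<-trans z<s p>1)

  p^a≢0 : ∀ {p} a → 1 < p → p ^ a ≢ 0
  p^a≢0 {p} a p>1 = ≢-nonZero⁻¹ (p ^ a) {{m^n≢0 p a {{>1⇒nonZero p>1}}}}

  ∣≢0 : ∀ {x n} → n ≢ 0 → x ∣ n → x ≢ 0
  ∣≢0 n≢0 x∣n refl = n≢0 (0∣⇒≡0 x∣n)

  *≢0 : ∀ {x y} → x ≢ 0 → y ≢ 0 → x * y ≢ 0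
  *≢0 {x} x≢0 y≢0 xy≡0 with m*n≡0⇒m≡0∨n≡0 x xy≡0
  ... | inj₁ x≡0 = x≢0 x≡0
  ... | inj₂ y≡0 = y≢0 y≡0

  strip≢0 : ∀ {p} d → 1 < p → d ≢ 0 → strip p d ≢ 0
  strip≢0 d p>1 d≢0 = ∣≢0 d≢0 (strip∣ d p>1)

  p^a*r-injective : ∀ {p} a b r s → 1 < p → p ∤ r → p ∤ s → p ^ a * r ≡ p ^ b * s → a ≡ b × r ≡ s
  p^a*r-injective zero zero r s p>1 p∤r p∤s e =
    refl , trans (sym (*-identityˡ r)) (trans e (*-identityˡ s))
  p^a*r-injective {p} zero (suc b) r s p>1 p∤r p∤s e =
    ⊥-elim (p∤r (subst (p ∣_) (trans (sym (*-assoc p (p ^ b) s)) (trans (sym e) (*-identityˡ r))) (m∣m*n (p ^ b * s))))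
  p^a*r-injective {p} (suc a) zero r s p>1 p∤r p∤s e =
    ⊥-elim (p∤s (subst (p ∣_) (trans (sym (*-assoc p (p ^ a) r)) (trans e (*-identityˡ s))) (m∣m*n (p ^ a * r))))
  p^a*r-injective {p} (suc a) (suc b) r s p>1 p∤r p∤s e =
    let a≡b , r≡s = p^a*r-injective a b r s p>1 p∤r p∤s
          (*-cancelˡ-≡ (p ^ a * r) (p ^ b * s) p {{>1⇒nonZero p>1}}
            (trans (sym (*-assoc p (p ^ a) r)) (trans e (*-assoc p (p ^ b) s))))
    in cong suc a≡b , r≡s

  ord-strip-unique : ∀ {p} d a r → 1 < p → d ≢ 0 → p ∤ r → d ≡ p ^ a * r → ord p d ≡ a × strip p d ≡ r
  ord-strip-unique d a r p>1 d≢0 p∤r e =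
    p^a*r-injective _ a _ r p>1 (p∤strip d p>1 d≢0) p∤r (trans (sym (d≡p^ord*strip d p>1)) e)

  ord≡0 : ∀ {p} d → 1 < p → d ≢ 0 → p ∤ d → ord p d ≡ 0
  ord≡0 d p>1 d≢0 p∤d = proj₁ (ord-strip-unique d 0 d p>1 d≢0 p∤d (sym (*-identityˡ d)))

  ord[p^a*r] : ∀ {p} a r → 1 < p → r ≢ 0 → p ∤ r → ord p (p ^ a * r) ≡ a
  ord[p^a*r] a r p>1 r≢0 p∤r = proj₁ (ord-strip-unique _ a r p>1 (*≢0 (p^a≢0 a p>1) r≢0) p∤r refl)

  ∣⇒ord>0 : ∀ {p} d → 1 < p → d ≢ 0 → p ∣ d → 0 < ord p d
  ∣⇒ord>0 {p} d p>1 d≢0 p∣d with ord p d in eq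
  ... | suc _ = z<s
  ... | zero  = ⊥-elim (p∤strip d p>1 d≢0 (subst (p ∣_) d≡strip p∣d))
    where d≡strip : d ≡ strip p d
          d≡strip = trans (d≡p^ord*strip d p>1) (trans (cong (λ a → p ^ a * strip p d) eq) (*-identityˡ _))

  ord>0⇒∣ : ∀ {p} d → 1 < p → 0 < ord p d → p ∣ d
  ord>0⇒∣ {p} d p>1 _ with ord p d | d≡p^ord*strip {p} d p>1
  ... | suc a | e = subst (p ∣_) (trans (sym (*-assoc p _ _)) (sym e)) (m∣m*n (p ^ a * strip p d))

  ord-* : ∀ {p} x y → Prime p → x ≢ 0 → y ≢ 0 → ord p (x * y) ≡ ord p x + ord p y
  ord-* {p} x y pp x≢0 y≢0 = proj₁ (ord-strip-unique (x * y) _ _ p>1 (*≢0 x≢0 y≢0) p∤rs decomposition)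
    where
    p>1 : 1 < p
    p>1 = prime⇒>1 pp
    p∤rs : p ∤ strip p x * strip p y
    p∤rs p∣rs with euclidsLemma (strip p x) (strip p y) pp p∣rs
    ... | inj₁ p∣r = p∤strip x p>1 x≢0 p∣r
    ... | inj₂ p∣s = p∤strip y p>1 y≢0 p∣s
    rearrange : ∀ P r Q s → (P * r) * (Q * s) ≡ (P * Q) * (r * s)
    rearrange = solve-∀
    decomposition : x * y ≡ p ^ (ord p x + ord p y) * (strip p x * strip p y)
    decomposition = begin
      x * y
        ≡⟨ cong₂ _*_ (d≡p^ord*strip x p>1) (d≡p^ord*strip y p>1) ⟩
      (p ^ ord p x * strip p x) * (p ^ ord p y * strip p y)
        ≡⟨ rearrange (p ^ ord p x) (strip p x) (p ^ ord p y) (strip p y) ⟩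
      (p ^ ord p x * p ^ ord p y) * (strip p x * strip p y)
        ≡⟨ cong (_* (strip p x * strip p y)) (^-distribˡ-+-* p (ord p x) (ord p y)) ⟨
      p ^ (ord p x + ord p y) * (strip p x * strip p y) ∎
      where open ≡-Reasoning

  private
    p^a∣p^b*s⇒a≤b : ∀ {p} a b s → 1 < p → p ∤ s → p ^ a ∣ p ^ b * s → a ≤ b
    p^a∣p^b*s⇒a≤b zero b s p>1 p∤s _ = z≤n
    p^a∣p^b*s⇒a≤b {p} (suc a) zero s p>1 p∤s d =
      ⊥-elim (p∤s (∣-trans (m∣m*n (p ^ a)) (subst (p * p ^ a ∣_) (*-identityˡ s) d)))
    p^a∣p^b*s⇒a≤b {p} (suc a) (suc b) s p>1 p∤s d =
      s≤s (p^a∣p^b*s⇒a≤b a b s p>1 p∤s (*-cancelˡ-∣ p {{>1⇒nonZero p>1}} (subst (p * p ^ a ∣_) (*-assoc p (p ^ b) s) d)))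

  ord-mono-∣ : ∀ {p} x n → 1 < p → n ≢ 0 → x ∣ n → ord p x ≤ ord p n
  ord-mono-∣ {p} x n p>1 n≢0 x∣n = p^a∣p^b*s⇒a≤b _ _ _ p>1 (p∤strip n p>1 n≢0)
    (subst (p ^ ord p x ∣_) (d≡p^ord*strip n p>1) (∣-trans p^ord∣x x∣n))
    where p^ord∣x : p ^ ord p x ∣ x
          p^ord∣x = divides (strip p x) (trans (d≡p^ord*strip x p>1) (*-comm (p ^ ord p x) (strip p x)))

  ∤⇒coprime : ∀ {p s} → Prime p → p ∤ s → Coprime s p
  ∤⇒coprime pp p∤s (d∣s , d∣p) with prime⇒irreducible pp d∣p
  ... | inj₁ d≡1 = d≡1
  ... | inj₂ refl = ⊥-elim (p∤s d∣s)

  private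
    ∤-cancel-p^v : ∀ {p s m} v → Prime p → p ∤ s → s ∣ p ^ v * m → s ∣ m
    ∤-cancel-p^v {s = s} {m} zero    pp p∤s d = subst (s ∣_) (*-identityˡ m) d
    ∤-cancel-p^v {p} {s} {m} (suc v) pp p∤s d =
      ∤-cancel-p^v v pp p∤s (coprime-divisor (∤⇒coprime pp p∤s) (subst (s ∣_) (*-assoc p (p ^ v) m) d))

  strip-∣ : ∀ {p} x v m → Prime p → x ≢ 0 → x ∣ p ^ v * m → strip p x ∣ m
  strip-∣ x v m pp x≢0 x∣n =
    ∤-cancel-p^v v pp (p∤strip x (prime⇒>1 pp) x≢0) (∣-trans (strip∣ x (prime⇒>1 pp)) x∣n)

  prime∤prime^ : ∀ {p q} a → Prime p → Prime q → p ≢ q → p ∤ q ^ a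
  prime∤prime^ zero pp pq p≢q p∣1 = <⇒≢ (prime⇒>1 pp) (sym (∣1⇒≡1 p∣1))
  prime∤prime^ {p} {q} (suc a) pp pq p≢q p∣q^a with euclidsLemma q (q ^ a) pp p∣q^a
  ... | inj₂ p∣q^a′ = prime∤prime^ a pp pq p≢q p∣q^a′
  ... | inj₁ p∣q with prime⇒irreducible pq p∣q
  ...   | inj₁ p≡1 = <⇒≢ (prime⇒>1 pp) (sym p≡1)
  ...   | inj₂ p≡q = p≢q p≡q

  ord-strip-other : ∀ {p q} d → Prime p → Prime q → p ≢ q → d ≢ 0 → ord p (strip q d) ≡ ord p d
  ord-strip-other {p} {q} d pp pq p≢q d≢0 = sym (begin
    ord p d
      ≡⟨ cong (ord p) (d≡p^ord*strip d q>1) ⟩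
    ord p (q ^ ord q d * strip q d)
      ≡⟨ ord-* _ _ pp (p^a≢0 (ord q d) q>1) (strip≢0 d q>1 d≢0) ⟩
    ord p (q ^ ord q d) + ord p (strip q d)
      ≡⟨ cong (_+ ord p (strip q d)) (ord≡0 _ (prime⇒>1 pp) (p^a≢0 (ord q d) q>1) (prime∤prime^ (ord q d) pp pq p≢q)) ⟩
    ord p (strip q d) ∎)
    where open ≡-Reasoning
          q>1 : 1 < q
          q>1 = prime⇒>1 pq

  prime∣coprime⇒⊥ : ∀ {p x y} → Prime p → Coprime x y → p ∣ x → p ∣ y → ⊥
  prime∣coprime⇒⊥ pp x⊥y p∣x p∣y = <⇒≢ (prime⇒>1 pp) (sym (x⊥y (p∣x , p∣y)))

module ExponentCodes where

  open import Data.Nat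
  open import Data.Nat.Properties
  import Data.Fin.Properties as Fin

  AtMostOneNonzero : ∀ {m} → Vec ℕ m → Set
  AtMostOneNonzero es = ∀ a b → a ≢ b → lookup es a ≡ 0 ⊎ lookup es b ≡ 0

  BoundedBy : ∀ {m} → ℕ → Vec ℕ m → Set
  BoundedBy v es = ∀ l → lookup es l ≤ v

  -- A vector of exponents whose only nonzero entry is a ∈ [1, v], at position i (counted from 0),
  -- is encoded by i v + a; the zero vector by 0.
  shift : ℕ → ℕ → ℕ
  shift v zero    = zero
  shift v (suc c) = v + suc c

  code : ∀ {m} → ℕ → Vec ℕ m → ℕ
  code v []       = 0
  code v (e ∷ es) = e + shift v (code v es)

  private
    module _ {m e : ℕ} {es : Vec ℕ m} where
      amo-tail : AtMostOneNonzero (e ∷ es) → AtMostOneNonzero es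
      amo-tail amo a b a≢b = amo (suc a) (suc b) (a≢b ∘ Fin.suc-injective)

      amo-head : AtMostOneNonzero (e ∷ es) → e ≢ 0 → ∀ l → lookup es l ≡ 0
      amo-head amo e≢0 l with amo zero (suc l) (λ ())
      ... | inj₁ e≡0  = ⊥-elim (e≢0 e≡0)
      ... | inj₂ es≡0 = es≡0

  code-zeros : ∀ {m} v (es : Vec ℕ m) → (∀ l → lookup es l ≡ 0) → code v es ≡ 0
  code-zeros v []       zeros = refl
  code-zeros v (e ∷ es) zeros rewrite zeros zero | code-zeros v es (zeros ∘ suc) = refl

  private
    shift-+suc : ∀ v c a → shift v (c + suc a) ≡ v + (c + suc a)
    shift-+suc v c a rewrite +-suc c a = refl

  code-single : ∀ {m} v (es : Vec ℕ m) i a → lookup es i ≡ suc a → (∀ l → l ≢ i → lookup es l ≡ 0) →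
                code v es ≡ toℕ i * v + suc a
  code-single v (e ∷ es) zero a e≡1+a zeros
    rewrite e≡1+a | code-zeros v es (λ l → zeros (suc l) (λ ())) = +-identityʳ (suc a)
  code-single v (e ∷ es) (suc i) a es[i]≡1+a zeros = begin
    e + shift v (code v es)          ≡⟨ cong₂ (λ x c → x + shift v c) (zeros zero (λ ())) code-tail ⟩
    shift v (toℕ i * v + suc a)      ≡⟨ shift-+suc v (toℕ i * v) a ⟩
    v + (toℕ i * v + suc a)          ≡⟨ +-assoc v (toℕ i * v) (suc a) ⟨
    v + toℕ i * v + suc a            ∎
    where open ≡-Reasoning
          code-tail : code v es ≡ toℕ i * v + suc a
          code-tail = code-single v es i a es[i]≡1+a (λ l l≢i → zeros (suc l) (l≢i ∘ Fin.suc-injective))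

  private
    code-head : ∀ {m} v a (es : Vec ℕ m) → AtMostOneNonzero (suc a ∷ es) → code v (suc a ∷ es) ≡ suc a
    code-head v a es amo =
      trans (cong (λ c → suc a + shift v c) (code-zeros v es (amo-head amo (λ ())))) (+-identityʳ (suc a))

  code-≤ : ∀ {m} v (es : Vec ℕ m) → BoundedBy v es → AtMostOneNonzero es → code v es ≤ m * v
  code-≤ v []          bnd amo = z≤n
  code-≤ v (zero ∷ es)  bnd amo = ≤-trans (shift≤ (code v es)) (+-monoʳ-≤ v (code-≤ v es (bnd ∘ suc) (amo-tail amo)))
    where shift≤ : ∀ c → shift v c ≤ v + c
          shift≤ zero    = z≤n
          shift≤ (suc c) = ≤-refl
  code-≤ v (suc a ∷ es) bnd amo = ≤-trans (≤-reflexive (code-head v a es amo)) (≤-trans (bnd zero) (m≤m+n v _))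

  private
    shift-injective : ∀ v c d → shift v c ≡ shift v d → c ≡ d
    shift-injective v zero    zero    eq = refl
    shift-injective v zero    (suc d) eq = ⊥-elim (m+1+n≢0 v (sym eq))
    shift-injective v (suc c) zero    eq = ⊥-elim (m+1+n≢0 v eq)
    shift-injective v (suc c) (suc d) eq = +-cancelˡ-≡ v (suc c) (suc d) eq

    shift-avoids : ∀ v a c → suc a ≤ v → suc a ≢ shift v c
    shift-avoids v a zero    a<v ()
    shift-avoids v a (suc c) a<v eq = m+1+n≰m v (≤-trans (≤-reflexive (sym eq)) a<v)

    zeros⇒≡ : ∀ {m} (es fs : Vec ℕ m) → (∀ l → lookup es l ≡ 0) → (∀ l → lookup fs l ≡ 0) → es ≡ fs
    zeros⇒≡ es fs es≡0 fs≡0 = lookup⇒≡ es fs (λ l → trans (es≡0 l) (sym (fs≡0 l)))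

  code-injective : ∀ {m} v (es fs : Vec ℕ m) → BoundedBy v es → AtMostOneNonzero es →
                   BoundedBy v fs → AtMostOneNonzero fs → code v es ≡ code v fs → es ≡ fs
  code-injective v [] [] _ _ _ _ _ = refl
  code-injective v (zero ∷ es) (zero ∷ fs) bnd₁ amo₁ bnd₂ amo₂ eq =
    cong (0 ∷_) (code-injective v es fs (bnd₁ ∘ suc) (amo-tail amo₁) (bnd₂ ∘ suc) (amo-tail amo₂) (shift-injective v _ _ eq))
  code-injective v (suc a ∷ es) (suc b ∷ fs) bnd₁ amo₁ bnd₂ amo₂ eq =
    cong₂ _∷_ (trans (sym (code-head v a es amo₁)) (trans eq (code-head v b fs amo₂)))
              (zeros⇒≡ es fs (amo-head amo₁ (λ ())) (amo-head amo₂ (λ ())))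
  code-injective v (suc a ∷ es) (zero ∷ fs) bnd₁ amo₁ bnd₂ amo₂ eq =
    ⊥-elim (shift-avoids v a (code v fs) (bnd₁ zero) (trans (sym (code-head v a es amo₁)) eq))
  code-injective v (zero ∷ es) (suc b ∷ fs) bnd₁ amo₁ bnd₂ amo₂ eq =
    ⊥-elim (shift-avoids v b (code v es) (bnd₂ zero) (trans (sym (code-head v b fs amo₂)) (sym eq)))

module IntegerSums where

  open import Data.Nat as ℕ using (ℕ; zero; suc)
  open import Data.Integer using (ℤ; +_; 0ℤ; 1ℤ; _+_; _*_; _-_; -_; _≤_; +≤+; +<+; -[1+_]; nonNegative; positive)
  open import Data.Integer.Properties
  open import Data.Integer.Tactic.RingSolver using (solve-∀)

  sq : ℤ → ℤ
  sq z = z * z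

  0≤sq : ∀ z → 0ℤ ≤ sq z
  0≤sq (+ n)      = subst (0ℤ ≤_) (pos-* n n) (+≤+ ℕ.z≤n)
  0≤sq -[1+ n ]   = +≤+ ℕ.z≤n

  ∑ : ∀ {A : Set} → (A → ℤ) → List A → ℤ
  ∑ f []       = 0ℤ
  ∑ f (x ∷ xs) = f x + ∑ f xs

  when : ∀ {P : Set} → Dec P → ℤ → ℤ
  when (yes _) z = z
  when (no _)  z = 0ℤ

  module _ {A : Set} where

    ∑-+ : ∀ (f g : A → ℤ) xs → ∑ (λ x → f x + g x) xs ≡ ∑ f xs + ∑ g xs
    ∑-+ f g []       = refl
    ∑-+ f g (x ∷ xs) rewrite ∑-+ f g xs = rearrange (f x) (g x) (∑ f xs) (∑ g xs)
      where rearrange : ∀ a b c d → a + b + (c + d) ≡ a + c + (b + d)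
            rearrange = solve-∀

    ∑-cong : ∀ {f g : A → ℤ} xs → (∀ {x} → x ∈ xs → f x ≡ g x) → ∑ f xs ≡ ∑ g xs
    ∑-cong []       eq = refl
    ∑-cong (x ∷ xs) eq = cong₂ _+_ (eq (here refl)) (∑-cong xs (eq ∘ there))

    ∑-mono-≤ : ∀ {f g : A → ℤ} xs → (∀ {x} → x ∈ xs → f x ≤ g x) → ∑ f xs ≤ ∑ g xs
    ∑-mono-≤ []       le = ≤-refl
    ∑-mono-≤ (x ∷ xs) le = +-mono-≤ (le (here refl)) (∑-mono-≤ xs (le ∘ there))

    ∑-nonNeg : ∀ (f : A → ℤ) xs → (∀ x → 0ℤ ≤ f x) → 0ℤ ≤ ∑ f xs
    ∑-nonNeg f []       _   = ≤-refl
    ∑-nonNeg f (x ∷ xs) f≥0 = +-mono-≤ (f≥0 x) (∑-nonNeg f xs f≥0)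

    ∑-zero : ∀ (xs : List A) → ∑ (λ _ → 0ℤ) xs ≡ 0ℤ
    ∑-zero []       = refl
    ∑-zero (x ∷ xs) = trans (+-identityˡ _) (∑-zero xs)

    ∑-*ˡ : ∀ c (f : A → ℤ) xs → ∑ (λ x → c * f x) xs ≡ c * ∑ f xs
    ∑-*ˡ c f []       = sym (*-zeroʳ c)
    ∑-*ˡ c f (x ∷ xs) rewrite ∑-*ˡ c f xs = sym (*-distribˡ-+ c (f x) (∑ f xs))

    ∑-const : ∀ c (xs : List A) → ∑ (λ _ → c) xs ≡ + length xs * c
    ∑-const c []       = sym (*-zeroˡ c)
    ∑-const c (x ∷ xs) rewrite ∑-const c xs = sym (suc-* (+ length xs) c)

    ∑-map : ∀ {B : Set} (f : B → ℤ) (g : A → B) xs → ∑ f (List.map g xs) ≡ ∑ (λ x → f (g x)) xs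
    ∑-map f g []       = refl
    ∑-map f g (x ∷ xs) = cong (λ s → f (g x) + s) (∑-map f g xs)

    ∑-++ : ∀ (f : A → ℤ) xs ys → ∑ f (xs ++ ys) ≡ ∑ f xs + ∑ f ys
    ∑-++ f []       ys = sym (+-identityˡ (∑ f ys))
    ∑-++ f (x ∷ xs) ys = trans (cong (λ s → f x + s) (∑-++ f xs ys)) (sym (+-assoc (f x) (∑ f xs) (∑ f ys)))

    ∑-swap : ∀ {B : Set} (f : A → B → ℤ) xs (ys : List B) →
             ∑ (λ y → ∑ (λ x → f x y) xs) ys ≡ ∑ (λ x → ∑ (f x) ys) xs
    ∑-swap f xs []       = sym (∑-zero xs)
    ∑-swap f xs (y ∷ ys) = trans (cong (λ s → ∑ (λ x → f x y) xs + s) (∑-swap f xs ys)) (sym (∑-+ (λ x → f x y) (λ x → ∑ (f x) ys) xs))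

    term≤∑ : ∀ (f : A → ℤ) {x} xs → x ∈ xs → (∀ y → 0ℤ ≤ f y) → f x ≤ ∑ f xs
    term≤∑ f (y ∷ xs) (here refl) f≥0 = i≤i+j (f y) (∑ f xs) {{nonNegative (∑-nonNeg f xs f≥0)}}
    term≤∑ f (y ∷ xs) (there x∈) f≥0 = ≤-trans (term≤∑ f xs x∈ f≥0) (i≤j+i (∑ f xs) (f y) {{nonNegative (f≥0 y)}})

  module _ {K : Set} (_≟_ : DecidableEquality K) where

    ∑-when-∉ : ∀ {k} z (ks : List K) → k ∉ ks → ∑ (λ κ → when (k ≟ κ) z) ks ≡ 0ℤ
    ∑-when-∉ {k} z []       k∉ = refl
    ∑-when-∉ {k} z (κ ∷ ks) k∉ with k ≟ κ
    ... | yes k≡κ = ⊥-elim (k∉ (here k≡κ))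
    ... | no _    = trans (+-identityˡ _) (∑-when-∉ z ks (k∉ ∘ there))

    ∑-when-∈ : ∀ {k} z (ks : List K) → Unique ks → k ∈ ks → ∑ (λ κ → when (k ≟ κ) z) ks ≡ z
    ∑-when-∈ {k} z (κ ∷ ks) (κ∉ks ∷ ks!) k∈ with k ≟ κ | k∈
    ... | yes refl | _         = trans (cong (λ s → z + s) (∑-when-∉ z ks (All¬⇒¬Any κ∉ks))) (+-identityʳ z)
    ... | no k≢κ   | here k≡κ  = ⊥-elim (k≢κ k≡κ)
    ... | no _     | there k∈′ = trans (+-identityˡ _) (∑-when-∈ z ks ks! k∈′)

    ∑-partition : ∀ {A : Set} (key : A → K) (ks : List K) → Unique ks → (f : A → ℤ) (xs : List A) →
                  All (λ x → key x ∈ ks) xs → ∑ f xs ≡ ∑ (λ κ → ∑ f (filter (λ x → key x ≟ κ) xs)) ks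
    ∑-partition key ks ks! f []       _            = sym (∑-zero ks)
    ∑-partition key ks ks! f (x ∷ xs) (x∈ks ∷ xs∈ks) = begin
      f x + ∑ f xs
        ≡⟨ cong₂ _+_ (sym (∑-when-∈ (f x) ks ks! x∈ks)) (∑-partition key ks ks! f xs xs∈ks) ⟩
      ∑ (λ κ → when (key x ≟ κ) (f x)) ks + ∑ (λ κ → ∑ f (filter (λ y → key y ≟ κ) xs)) ks
        ≡⟨ ∑-+ _ _ ks ⟨
      ∑ (λ κ → when (key x ≟ κ) (f x) + ∑ f (filter (λ y → key y ≟ κ) xs)) ks
        ≡⟨ ∑-cong ks (λ {κ} _ → ∑-filter-∷ κ) ⟩
      ∑ (λ κ → ∑ f (filter (λ y → key y ≟ κ) (x ∷ xs))) ks ∎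
      where
      open ≡-Reasoning
      ∑-filter-∷ : ∀ κ → when (key x ≟ κ) (f x) + ∑ f (filter (λ y → key y ≟ κ) xs)
                         ≡ ∑ f (filter (λ y → key y ≟ κ) (x ∷ xs))
      ∑-filter-∷ κ with key x ≟ κ
      ... | yes _ = refl
      ... | no _  = +-identityˡ _

    ∑-fibres-≤ : ∀ {A : Set} (view : A → K) (φ : K → ℤ) (xs : List A) k → (∀ κ → 0ℤ ≤ φ κ) →
                 (∀ κ → length (filter (λ x → view x ≟ κ) xs) ℕ.≤ k) →
                 ∑ (λ x → φ (view x)) xs ≤ + k * ∑ φ (deduplicate _≟_ (List.map view xs))
    ∑-fibres-≤ view φ xs k φ≥0 fibre≤k = begin
      ∑ (λ x → φ (view x)) xs                    ≡⟨ ∑-partition view ks (deduplicate-! _≟_ (List.map view xs)) _ xs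
                                                      (All.tabulate (∈-deduplicate⁺ _≟_ ∘ ∈-map⁺ view)) ⟩
      ∑ (λ κ → ∑ (λ x → φ (view x)) (fibre κ)) ks ≤⟨ ∑-mono-≤ ks (λ {κ} _ → fibre-bound κ) ⟩
      ∑ (λ κ → + k * φ κ) ks                     ≡⟨ ∑-*ˡ (+ k) φ ks ⟩
      + k * ∑ φ ks                               ∎
      where
      open ≤-Reasoning
      ks = deduplicate _≟_ (List.map view xs)
      fibre = λ κ → filter (λ x → view x ≟ κ) xs
      fibre-bound : ∀ κ → ∑ (λ x → φ (view x)) (fibre κ) ≤ + k * φ κ
      fibre-bound κ = begin
        ∑ (λ x → φ (view x)) (fibre κ) ≡⟨ ∑-cong (fibre κ) (cong φ ∘ proj₂ ∘ ∈-filter⁻ (λ x → view x ≟ κ) {xs = xs}) ⟩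
        ∑ (λ _ → φ κ) (fibre κ)        ≡⟨ ∑-const (φ κ) (fibre κ) ⟩
        + length (fibre κ) * φ κ       ≤⟨ *-monoʳ-≤-nonNeg (φ κ) {{nonNegative (φ≥0 κ)}} (+≤+ (fibre≤k κ)) ⟩
        + k * φ κ                      ∎

  private
    G-when : ∀ {P : Set} (d : Dec P) (G : ℤ → ℤ) w → G (when d w) ≡ G 0ℤ + when d (G w - G 0ℤ)
    G-when (yes _) G w = shuffle (G w) (G 0ℤ)
      where shuffle : ∀ a b → a ≡ b + (a - b)
            shuffle = solve-∀
    G-when (no _)  G w = sym (+-identityʳ (G 0ℤ))

  ∑-downFrom-when : ∀ (G : ℤ → ℤ) w {E M} → E ℕ.≤ M →
                    ∑ (λ κ → G (when (E ℕ.≟ κ) w)) (downFrom (suc M)) ≡ G w + + M * G 0ℤ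
  ∑-downFrom-when G w {E} {M} E≤M = begin
    ∑ (λ κ → G (when (E ℕ.≟ κ) w)) κs
      ≡⟨ ∑-cong κs (λ {κ} _ → G-when (E ℕ.≟ κ) G w) ⟩
    ∑ (λ κ → G 0ℤ + when (E ℕ.≟ κ) (G w - G 0ℤ)) κs
      ≡⟨ ∑-+ (λ _ → G 0ℤ) (λ κ → when (E ℕ.≟ κ) (G w - G 0ℤ)) κs ⟩
    ∑ (λ _ → G 0ℤ) κs + ∑ (λ κ → when (E ℕ.≟ κ) (G w - G 0ℤ)) κs
      ≡⟨ cong₂ _+_ (trans (∑-const (G 0ℤ) κs) (cong (λ l → + l * G 0ℤ) (length-downFrom (suc M))))
                   (∑-when-∈ ℕ._≟_ (G w - G 0ℤ) κs (downFrom⁺ (suc M)) (∈-downFrom⁺ (ℕ.s≤s E≤M))) ⟩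
    + suc M * G 0ℤ + (G w - G 0ℤ)
      ≡⟨ rearrange (+ M) (G w) (G 0ℤ) ⟩
    G w + + M * G 0ℤ ∎
    where
    open ≡-Reasoning
    κs = downFrom (suc M)
    rearrange : ∀ m a b → (1ℤ + m) * b + (a - b) ≡ a + m * b
    rearrange = solve-∀

  private
    +-cancelˡ-≤ : ∀ {a b c} → a + b ≤ a + c → b ≤ c
    +-cancelˡ-≤ {a} {b} {c} le = begin
      b          ≡⟨ cancel a b ⟩
      a + b - a  ≤⟨ +-monoˡ-≤ (- a) le ⟩
      a + c - a  ≡⟨ cancel a c ⟨
      c          ∎
      where open ≤-Reasoning
            cancel : ∀ a b → b ≡ a + b - a
            cancel = solve-∀

    am-gm : ∀ T m y → + 2 * T * (m * m) * y ≤ T * T + m * m * m * m * sq y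
    am-gm T m y = 0≤i-j⇒j≤i (≤-trans (0≤sq (T - m * m * y)) (≤-reflexive (expand T m y)))
      where expand : ∀ T m y → (T - m * m * y) * (T - m * m * y) ≡ T * T + m * m * m * m * (y * y) - + 2 * T * (m * m) * y
            expand = solve-∀

    ∑-am-gm : ∀ {A : Set} T m (f : A → ℤ) xs →
              + 2 * T * (m * m) * ∑ f xs ≤ + length xs * (T * T) + m * m * m * m * ∑ (λ x → sq (f x)) xs
    ∑-am-gm T m f [] = ≤-reflexive (zeros T m)
      where zeros : ∀ T m → + 2 * T * (m * m) * 0ℤ ≡ 0ℤ * (T * T) + m * m * m * m * 0ℤ
            zeros = solve-∀
    ∑-am-gm T m f (x ∷ xs) = begin
      + 2 * T * (m * m) * (f x + ∑ f xs)
        ≡⟨ *-distribˡ-+ (+ 2 * T * (m * m)) (f x) (∑ f xs) ⟩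
      + 2 * T * (m * m) * f x + + 2 * T * (m * m) * ∑ f xs
        ≤⟨ +-mono-≤ (am-gm T m (f x)) (∑-am-gm T m f xs) ⟩
      T * T + m * m * m * m * sq (f x) + (+ length xs * (T * T) + m * m * m * m * ∑ (λ x → sq (f x)) xs)
        ≡⟨ collect T m (sq (f x)) (+ length xs) (∑ (λ x → sq (f x)) xs) ⟩
      (1ℤ + + length xs) * (T * T) + m * m * m * m * (sq (f x) + ∑ (λ x → sq (f x)) xs) ∎
      where
      open ≤-Reasoning
      collect : ∀ T m s l S → T * T + m * m * m * m * s + (l * (T * T) + m * m * m * m * S)
                              ≡ (1ℤ + l) * (T * T) + m * m * m * m * (s + S)
      collect = solve-∀

  -- Cauchy–Schwarz, obtained by summing the AM-GM inequalities 2 T m² y ≤ T² + m⁴ y².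
  sq≤cube*∑sq : ∀ {A : Set} (f : A → ℤ) xs T → 0 ℕ.< length xs → 0ℤ ≤ T → T ≤ + length xs * ∑ f xs →
                sq T ≤ + length xs * + length xs * + length xs * ∑ (λ x → sq (f x)) xs
  sq≤cube*∑sq f xs T 0<m 0≤T T≤mΣ =
    *-cancelˡ-≤-pos (sq T) (m * m * m * Q) m {{positive (+<+ 0<m)}} (+-cancelˡ-≤ {m * sq T} (begin
      m * sq T + m * sq T                  ≡⟨ double m T ⟩
      (+ 2 * m * T) * T                    ≤⟨ *-monoˡ-≤-nonNeg (+ 2 * m * T) {{nonNegative 0≤2mT}} T≤mΣ ⟩
      (+ 2 * m * T) * (m * ∑ f xs)         ≡⟨ regroup m T (∑ f xs) ⟩
      + 2 * T * (m * m) * ∑ f xs           ≤⟨ ∑-am-gm T m f xs ⟩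
      m * (T * T) + m * m * m * m * Q      ≡⟨ cong (λ s → m * sq T + s) (quartic m Q) ⟩
      m * sq T + m * (m * m * m * Q)       ∎))
    where
    open ≤-Reasoning
    m = + length xs
    Q = ∑ (λ x → sq (f x)) xs
    0≤2mT : 0ℤ ≤ + 2 * m * T
    0≤2mT = subst (_≤ + 2 * m * T) (*-zeroʳ (+ 2 * m))
                  (*-monoˡ-≤-nonNeg (+ 2 * m) {{nonNegative (subst (0ℤ ≤_) (pos-* 2 (length xs)) (+≤+ ℕ.z≤n))}} 0≤T)
    double : ∀ m T → m * (T * T) + m * (T * T) ≡ (+ 2 * m * T) * T
    double = solve-∀
    regroup : ∀ m T S → (+ 2 * m * T) * (m * S) ≡ + 2 * T * (m * m) * S
    regroup = solve-∀
    quartic : ∀ m Q → m * m * m * m * Q ≡ m * (m * m * m * Q)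
    quartic = solve-∀

module PrimePowerLists where

  open import Data.Nat
  open import Data.Nat.Properties
  open import Data.Nat.Divisibility
  open Valuation
  open ExponentCodes

  codeAt : ∀ {m} → ℕ → ℕ → Vec ℕ m → ℕ
  codeAt p v x = code v (map (ord p) x)

  map-ord-strip : ∀ {m p q} (x : Vec ℕ m) → Prime p → Prime q → q ≢ p → (∀ l → lookup x l ≢ 0) →
                  map (ord q) (map (strip p) x) ≡ map (ord q) x
  map-ord-strip []      pp pq q≢p x≢0 = refl
  map-ord-strip (a ∷ x) pp pq q≢p x≢0 =
    cong₂ _∷_ (ord-strip-other a pq pp q≢p (x≢0 zero)) (map-ord-strip x pp pq q≢p (x≢0 ∘ suc))

  PrimePowers : Set
  PrimePowers = List (ℕ × ℕ)

  ⟦_⟧ : PrimePowers → ℕ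
  ⟦ []           ⟧ = 1
  ⟦ (p , v) ∷ ds ⟧ = p ^ v * ⟦ ds ⟧

  Ω′ : PrimePowers → ℕ
  Ω′ []             = 0
  Ω′ ((p , v) ∷ ds) = v + Ω′ ds

  Avoids : ℕ → PrimePowers → Set
  Avoids p = All ((_≢ p) ∘ proj₁)

  Canonical : PrimePowers → Set
  Canonical []             = ⊤
  Canonical ((p , v) ∷ ds) = Prime p × 1 ≤ v × Avoids p ds × Canonical ds

  p∤⟦⟧ : ∀ {p} ds → Prime p → Avoids p ds → Canonical ds → p ∤ ⟦ ds ⟧
  p∤⟦⟧ [] pp _ _ p∣1 = <⇒≢ (prime⇒>1 pp) (sym (∣1⇒≡1 p∣1))
  p∤⟦⟧ ((q , w) ∷ ds) pp (q≢p ∷ avoids) (pq , _ , _ , can) p∣ with euclidsLemma (q ^ w) ⟦ ds ⟧ pp p∣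
  ... | inj₁ p∣q^w = prime∤prime^ w pp pq (q≢p ∘ sym) p∣q^w
  ... | inj₂ p∣⟦ds⟧ = p∤⟦⟧ ds pp avoids can p∣⟦ds⟧

  ⟦⟧≢0 : ∀ ds → Canonical ds → ⟦ ds ⟧ ≢ 0
  ⟦⟧≢0 []             _                  ()
  ⟦⟧≢0 ((p , v) ∷ ds) (pp , _ , _ , can) = *≢0 (p^a≢0 v (prime⇒>1 pp)) (⟦⟧≢0 ds can)

  ExactPowersOf : ℕ → PrimePowers → Set
  ExactPowersOf n = All (λ pv → Prime (proj₁ pv) × 1 ≤ proj₂ pv × ord (proj₁ pv) n ≡ proj₂ pv)

  canonical⇒exact : ∀ ds → Canonical ds → ExactPowersOf ⟦ ds ⟧ ds
  canonical⇒exact []             _                           = []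
  canonical⇒exact ((p , v) ∷ ds) (pp , 1≤v , avoids , can) =
    (pp , 1≤v , ord[p^a*r] v ⟦ ds ⟧ p>1 (⟦⟧≢0 ds can) (p∤⟦⟧ ds pp avoids can)) ∷
    extend ds avoids (canonical⇒exact ds can)
    where
    p>1 : 1 < p
    p>1 = prime⇒>1 pp
    extend : ∀ es → Avoids p es → ExactPowersOf ⟦ ds ⟧ es → ExactPowersOf (p ^ v * ⟦ ds ⟧) es
    extend []             _                _                          = []
    extend ((q , w) ∷ es) (q≢p ∷ avoids′) ((pq , 1≤w , ord≡w) ∷ exact) =
      (pq , 1≤w , trans (ord-* (p ^ v) ⟦ ds ⟧ pq (p^a≢0 v p>1) (⟦⟧≢0 ds can))
                        (cong₂ _+_ (ord≡0 (p ^ v) (prime⇒>1 pq) (p^a≢0 v p>1) (prime∤prime^ v pq pp q≢p)) ord≡w))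
      ∷ extend es avoids′ exact

  module Stripping {p v m j : ℕ} (pp : Prime p) (p∤m : p ∤ m) (m≢0 : m ≢ 0) where

    private
      p>1 : 1 < p
      p>1 = prime⇒>1 pp

    n≢0 : p ^ v * m ≢ 0
    n≢0 = *≢0 (p^a≢0 v p>1) m≢0

    module _ {x : Vec ℕ j} (x-reg : RegularTuple (p ^ v * m) j x) where

      entries≢0 : ∀ l → lookup x l ≢ 0
      entries≢0 l = ∣≢0 n≢0 (proj₁ x-reg l)

      ords-bounded : BoundedBy v (map (ord p) x)
      ords-bounded l rewrite lookup-map l (ord p) x =
        subst (ord p (lookup x l) ≤_) (ord[p^a*r] v m p>1 m≢0 p∤m) (ord-mono-∣ (lookup x l) _ p>1 n≢0 (proj₁ x-reg l))

      ords-amo : AtMostOneNonzero (map (ord p) x)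
      ords-amo a b a≢b rewrite lookup-map a (ord p) x | lookup-map b (ord p) x
        with ord p (lookup x a) ≟ 0 | ord p (lookup x b) ≟ 0
      ... | yes ≡0 | _      = inj₁ ≡0
      ... | no _   | yes ≡0 = inj₂ ≡0
      ... | no ≢0ₐ | no ≢0ᵦ = ⊥-elim (prime∣coprime⇒⊥ pp (proj₂ x-reg a b a≢b)
                                (ord>0⇒∣ _ p>1 (n≢0⇒n>0 ≢0ₐ)) (ord>0⇒∣ _ p>1 (n≢0⇒n>0 ≢0ᵦ)))

      strip-regular : RegularTuple m j (map (strip p) x)
      strip-regular =
        (λ l → subst (_∣ m) (sym (lookup-map l (strip p) x)) (strip-∣ (lookup x l) v m pp (entries≢0 l) (proj₁ x-reg l))) ,
        (λ a b a≢b {d} (d∣a , d∣b) → proj₂ x-reg a b a≢b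
          (∣-trans (subst (d ∣_) (lookup-map a (strip p) x) d∣a) (strip∣ (lookup x a) p>1) ,
           ∣-trans (subst (d ∣_) (lookup-map b (strip p) x) d∣b) (strip∣ (lookup x b) p>1)))

      codeAt-< : codeAt p v x < suc (j * v)
      codeAt-< = s≤s (code-≤ v (map (ord p) x) ords-bounded ords-amo)

    codeAt-strip-injective : ∀ {x y : Vec ℕ j} → RegularTuple (p ^ v * m) j x → RegularTuple (p ^ v * m) j y →
                             codeAt p v x ≡ codeAt p v y → map (strip p) x ≡ map (strip p) y → x ≡ y
    codeAt-strip-injective {x} {y} x-reg y-reg same-code same-strip = lookup⇒≡ x y λ l → begin
      lookup x l
        ≡⟨ d≡p^ord*strip (lookup x l) p>1 ⟩
      p ^ ord p (lookup x l) * strip p (lookup x l)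
        ≡⟨ cong₂ (λ a s → p ^ a * s) (same-at (ord p) same-ords l) (same-at (strip p) same-strip l) ⟩
      p ^ ord p (lookup y l) * strip p (lookup y l)
        ≡⟨ d≡p^ord*strip (lookup y l) p>1 ⟨
      lookup y l ∎
      where
      open ≡-Reasoning
      same-ords : map (ord p) x ≡ map (ord p) y
      same-ords = code-injective v (map (ord p) x) (map (ord p) y) (ords-bounded {x} x-reg) (ords-amo {x} x-reg)
                                   (ords-bounded {y} y-reg) (ords-amo {y} y-reg) same-code
      same-at : ∀ f → map f x ≡ map f y → ∀ l → f (lookup x l) ≡ f (lookup y l)
      same-at f eq l = trans (sym (lookup-map l f x)) (trans (cong (λ z → lookup z l) eq) (lookup-map l f y))

module Counts (j : ℕ) where

  open import Data.Nat
  open import Data.Nat.Properties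
  open import Data.Nat.Tactic.RingSolver using (solve-∀)
  open PrimePowerLists

  κ′ : PrimePowers → ℕ
  κ′ []             = 1
  κ′ ((p , v) ∷ ds) = (j * v + 1) * κ′ ds

  κ′≢0 : ∀ ds → κ′ ds ≢ 0
  κ′≢0 []             ()
  κ′≢0 ((p , v) ∷ ds) = Valuation.*≢0 (m+1+n≢0 (j * v)) (κ′≢0 ds)

  -- κ′ ds ² times the variance of the score with weights W over the regular tuples (see spread-closed).
  spread : (W : ℕ → ℕ) → PrimePowers → ℕ
  spread W []             = 0
  spread W ((p , v) ∷ ds) = (j * v + 1) * (j * v + 1) * spread W ds + W v * W v * (κ′ ds * κ′ ds) * (j * v)

  private
    weight²-bound : ∀ w v → w ≤ 2 * v → w * w * (j * v * j) ≤ 4 * ((j * v + 1) * (j * v + 1)) * v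
    weight²-bound w v w≤2v = begin
      w * w * (j * v * j)                    ≤⟨ *-monoˡ-≤ (j * v * j) (*-mono-≤ w≤2v w≤2v) ⟩
      (2 * v) * (2 * v) * (j * v * j)        ≡⟨ regroup v j ⟩
      4 * ((j * v) * (j * v)) * v            ≤⟨ *-monoˡ-≤ v (*-monoʳ-≤ 4 (*-mono-≤ (m≤m+n (j * v) 1) (m≤m+n (j * v) 1))) ⟩
      4 * ((j * v + 1) * (j * v + 1)) * v    ∎
      where open ≤-Reasoning
            regroup : ∀ v j → (2 * v) * (2 * v) * (j * v * j) ≡ 4 * ((j * v) * (j * v)) * v
            regroup = solve-∀

  j*spread≤ : ∀ W → (∀ v → W v ≤ 2 * v) → ∀ ds → j * spread W ds ≤ 4 * κ′ ds * κ′ ds * Ω′ ds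
  j*spread≤ W W≤2v []             = ≤-reflexive (*-zeroʳ j)
  j*spread≤ W W≤2v ((p , v) ∷ ds) = begin
    j * (K * K * D + w * w * (N * N) * (j * v))        ≡⟨ distribute j K D w N v ⟩
    K * K * (j * D) + (w * w * (j * v * j)) * (N * N)  ≤⟨ +-mono-≤ (*-monoʳ-≤ (K * K) (j*spread≤ W W≤2v ds))
                                                                   (*-monoˡ-≤ (N * N) (weight²-bound w v (W≤2v v))) ⟩
    K * K * (4 * N * N * ω) + (4 * (K * K) * v) * (N * N) ≡⟨ collect K N ω v ⟩
    4 * (K * N) * (K * N) * (v + ω)                    ∎
    where
    open ≤-Reasoning
    K = j * v + 1
    D = spread W ds
    w = W v
    N = κ′ ds
    ω = Ω′ ds
    distribute : ∀ j K D w N v → j * (K * K * D + w * w * (N * N) * (j * v)) ≡ K * K * (j * D) + (w * w * (j * v * j)) * (N * N)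
    distribute = solve-∀
    collect : ∀ K N ω v → K * K * (4 * N * N * ω) + (4 * (K * K) * v) * (N * N) ≡ 4 * (K * N) * (K * N) * (v + ω)
    collect = solve-∀

module Variance (j : ℕ) where

  open import Data.Nat as ℕ using (ℕ; zero; suc)
  open import Data.Nat.Divisibility using (∣1⇒≡1)
  open import Data.Integer using (ℤ; +_; 0ℤ; 1ℤ; _+_; _*_; _-_; _≤_; +≤+; nonNegative)
  open import Data.Integer.Properties
  open import Data.Integer.Tactic.RingSolver using (solve-∀)
  open Valuation
  open ExponentCodes using (code)
  open IntegerSums
  open PrimePowerLists
  open Counts j

  score : (E W : ℕ → ℕ) → PrimePowers → Vec ℕ j → ℤ
  score E W []             x = 0ℤ
  score E W ((p , v) ∷ ds) x = when (E v ℕ.≟ codeAt p v x) (+ W v) + score E W ds x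

  -- The regular j-tuples of p ^ v * m are in bijection with pairs (code at p, regular j-tuple of m),
  -- and there are j v + 1 codes. Hence the following recursions compute, over all regular j-tuples x
  -- of ⟦ ds ⟧, the sums of score x, of (score x)², and of (a * score x - c)² respectively.
  scoreTotal : (W : ℕ → ℕ) → PrimePowers → ℤ
  scoreTotal W []             = 0ℤ
  scoreTotal W ((p , v) ∷ ds) = (+ (j ℕ.* v) + 1ℤ) * scoreTotal W ds + + W v * + κ′ ds

  scoreSquareTotal : (W : ℕ → ℕ) → PrimePowers → ℤ
  scoreSquareTotal W []             = 0ℤ
  scoreSquareTotal W ((p , v) ∷ ds) =
    (+ (j ℕ.* v) + 1ℤ) * scoreSquareTotal W ds + + 2 * + W v * scoreTotal W ds + + W v * + W v * + κ′ ds

  deviationTotal : (W : ℕ → ℕ) → PrimePowers → ℤ → ℤ → ℤ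
  deviationTotal W []             a c = sq c
  deviationTotal W ((p , v) ∷ ds) a c = deviationTotal W ds a (c - a * + W v) + + (j ℕ.* v) * deviationTotal W ds a c

  private
    regular[1] : ∀ {x} → RegularTuple 1 j x → x ≡ replicate j 1
    regular[1] {x} x-reg = lookup⇒≡ x _ (λ l → trans (∣1⇒≡1 (proj₁ x-reg l)) (sym (lookup-replicate l 1)))

    score-step : ∀ {P : Set} (d : Dec P) a w F c → a * (when d w + F) - c ≡ a * F - (c - when d (a * w))
    score-step (yes _) a w F c = step a w F c
      where step : ∀ a w F c → a * (w + F) - c ≡ a * F - (c - a * w)
            step = solve-∀
    score-step (no _)  a w F c = step a F c
      where step : ∀ a F c → a * (0ℤ + F) - c ≡ a * F - (c - 0ℤ)
            step = solve-∀

  score-strip : ∀ E W {p} ds (x : Vec ℕ j) → Prime p → Avoids p ds → Canonical ds → (∀ l → lookup x l ≢ 0) →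
                score E W ds (map (strip p) x) ≡ score E W ds x
  score-strip E W []             x pp _              _                 x≢0 = refl
  score-strip E W ((q , w) ∷ ds) x pp (q≢p ∷ avoids) (pq , _ , _ , can) x≢0 =
    cong₂ (λ c s → when (E w ℕ.≟ code w c) (+ W w) + s) (map-ord-strip x pp pq q≢p x≢0) (score-strip E W ds x pp avoids can x≢0)

  private
    ∑sq-score-class≤ : ∀ E W {p v} ds → Prime p → Avoids p ds → Canonical ds → ∀ a →
      (∀ Y → Unique Y → All (RegularTuple ⟦ ds ⟧ j) Y → ∀ c → ∑ (λ y → sq (a * score E W ds y - c)) Y ≤ deviationTotal W ds a c) →
      ∀ κ X → Unique X → All (RegularTuple ⟦ (p , v) ∷ ds ⟧ j) X → All (λ x → codeAt p v x ≡ κ) X → ∀ c →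
      ∑ (λ x → sq (a * score E W ((p , v) ∷ ds) x - c)) X ≤ deviationTotal W ds a (c - when (E v ℕ.≟ κ) (a * + W v))
    ∑sq-score-class≤ E W {p} {v} ds pp avoids can a bound κ X X! X-reg X-code c = begin
      ∑ (λ x → sq (a * score E W ((p , v) ∷ ds) x - c)) X  ≡⟨ ∑-cong X (cong sq ∘ peel) ⟩
      ∑ (λ x → ψ (map (strip p) x)) X                       ≡⟨ ∑-map ψ (map (strip p)) X ⟨
      ∑ ψ (List.map (map (strip p)) X)                      ≤⟨ bound _ stripped! stripped-reg c′ ⟩
      deviationTotal W ds a c′                              ∎
      where
      open ≤-Reasoning
      module S = PrimePowerLists.Stripping {p} {v} {⟦ ds ⟧} {j} pp (p∤⟦⟧ ds pp avoids can) (⟦⟧≢0 ds can)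
      c′ = c - when (E v ℕ.≟ κ) (a * + W v)
      ψ = λ y → sq (a * score E W ds y - c′)
      peel : ∀ {x} → x ∈ X → a * score E W ((p , v) ∷ ds) x - c ≡ a * score E W ds (map (strip p) x) - c′
      peel {x} x∈ = trans (cong₂ (λ κ′ s → a * (when (E v ℕ.≟ κ′) (+ W v) + s) - c) (All.lookup X-code x∈)
                                 (sym (score-strip E W ds x pp avoids can (S.entries≢0 {x} (All.lookup X-reg x∈)))))
                          (score-step (E v ℕ.≟ κ) a (+ W v) _ c)
      stripped! : Unique (List.map (map (strip p)) X)
      stripped! = Unique-map⁺ (map (strip p))
        (λ x∈ y∈ → S.codeAt-strip-injective (All.lookup X-reg x∈) (All.lookup X-reg y∈)
                                            (trans (All.lookup X-code x∈) (sym (All.lookup X-code y∈))))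
        X!
      stripped-reg : All (RegularTuple ⟦ ds ⟧ j) (List.map (map (strip p)) X)
      stripped-reg = All⁺.map⁺ (All.map (λ {x} → S.strip-regular {x}) X-reg)

  ∑sq-score≤deviationTotal : ∀ E W ds → Canonical ds → (∀ v → 1 ℕ.≤ v → E v ℕ.≤ j ℕ.* v) →
    ∀ X → Unique X → All (RegularTuple ⟦ ds ⟧ j) X →
    ∀ a c → ∑ (λ x → sq (a * score E W ds x - c)) X ≤ deviationTotal W ds a c
  ∑sq-score≤deviationTotal E W [] _ _ X X! X-reg a c = begin
    ∑ (λ x → sq (a * 0ℤ - c)) X    ≡⟨ ∑-const (sq (a * 0ℤ - c)) X ⟩
    + length X * sq (a * 0ℤ - c)   ≡⟨ cong (λ s → + length X * s) (square-neg a c) ⟩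
    + length X * sq c              ≤⟨ *-monoʳ-≤-nonNeg (sq c) {{nonNegative (0≤sq c)}} (+≤+ at-most-one) ⟩
    + 1 * sq c                     ≡⟨ *-identityˡ (sq c) ⟩
    sq c                           ∎
    where
    open ≤-Reasoning
    square-neg : ∀ a c → (a * 0ℤ - c) * (a * 0ℤ - c) ≡ c * c
    square-neg = solve-∀
    at-most-one : length X ℕ.≤ 1
    at-most-one = Unique-const⇒length≤1 X X! (All.map regular[1] X-reg)
  ∑sq-score≤deviationTotal E W ((p , v) ∷ ds) (pp , 1≤v , avoids , can) E≤jv X X! X-reg a c = begin
    ∑ φ X                                           ≡⟨ ∑-partition ℕ._≟_ (codeAt p v) κs (downFrom⁺ _) φ X
                                                         (All.map (λ {x} → ∈-downFrom⁺ ∘ S.codeAt-< {x}) X-reg) ⟩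
    ∑ (λ κ → ∑ φ (class κ)) κs                      ≤⟨ ∑-mono-≤ κs (λ {κ} _ → class-bound κ) ⟩
    ∑ (λ κ → G (when (E v ℕ.≟ κ) (a * + W v))) κs   ≡⟨ ∑-downFrom-when G (a * + W v) (E≤jv v 1≤v) ⟩
    G (a * + W v) + + (j ℕ.* v) * G 0ℤ              ≡⟨ cong (λ c′ → G (a * + W v) + + (j ℕ.* v) * deviationTotal W ds a c′)
                                                         (+-identityʳ c) ⟩
    deviationTotal W ((p , v) ∷ ds) a c             ∎
    where
    open ≤-Reasoning
    module S = PrimePowerLists.Stripping {p} {v} {⟦ ds ⟧} {j} pp (p∤⟦⟧ ds pp avoids can) (⟦⟧≢0 ds can)
    κs = downFrom (suc (j ℕ.* v))
    φ = λ x → sq (a * score E W ((p , v) ∷ ds) x - c)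
    G = λ z → deviationTotal W ds a (c - z)
    class = λ κ → filter (λ x → codeAt p v x ℕ.≟ κ) X
    class-bound : ∀ κ → ∑ φ (class κ) ≤ G (when (E v ℕ.≟ κ) (a * + W v))
    class-bound κ = ∑sq-score-class≤ E W ds pp avoids can a (λ Y Y! Y-reg → ∑sq-score≤deviationTotal E W ds can E≤jv Y Y! Y-reg a) κ (class κ)
      (Unique.filter⁺ _ X!) (All⁺.filter⁺ _ X-reg) (All⁺.all-filter _ X) c

  private
    +κ′-step : ∀ p v ds → + κ′ ((p , v) ∷ ds) ≡ (+ (j ℕ.* v) + 1ℤ) * + κ′ ds
    +κ′-step p v ds = trans (pos-* (j ℕ.* v ℕ.+ 1) (κ′ ds)) (cong (_* + κ′ ds) (pos-+ (j ℕ.* v) 1))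

    +spread-step : ∀ W p v ds → let jv = + (j ℕ.* v); w = + W v; N = + κ′ ds in
      + spread W ((p , v) ∷ ds) ≡ (jv + 1ℤ) * (jv + 1ℤ) * + spread W ds + w * w * (N * N) * jv
    +spread-step W p v ds = begin
      + (k ℕ.* k ℕ.* D ℕ.+ W v ℕ.* W v ℕ.* (κ′ ds ℕ.* κ′ ds) ℕ.* (j ℕ.* v))
        ≡⟨ pos-+ (k ℕ.* k ℕ.* D) _ ⟩
      + (k ℕ.* k ℕ.* D) + + (W v ℕ.* W v ℕ.* (κ′ ds ℕ.* κ′ ds) ℕ.* (j ℕ.* v))
        ≡⟨ cong₂ _+_ (trans (pos-* (k ℕ.* k) D) (cong (_* + D) (pos-* k k)))
                     (trans (pos-* (W v ℕ.* W v ℕ.* (κ′ ds ℕ.* κ′ ds)) (j ℕ.* v))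
                       (cong (_* + (j ℕ.* v)) (trans (pos-* (W v ℕ.* W v) _) (cong₂ _*_ (pos-* (W v) (W v)) (pos-* (κ′ ds) (κ′ ds)))))) ⟩
      + k * + k * + D + + W v * + W v * (+ κ′ ds * + κ′ ds) * + (j ℕ.* v)
        ≡⟨ cong (λ K → K * K * + D + + W v * + W v * (+ κ′ ds * + κ′ ds) * + (j ℕ.* v)) (pos-+ (j ℕ.* v) 1) ⟩
      (+ (j ℕ.* v) + 1ℤ) * (+ (j ℕ.* v) + 1ℤ) * + D + + W v * + W v * (+ κ′ ds * + κ′ ds) * + (j ℕ.* v) ∎
      where open ≡-Reasoning
            k = j ℕ.* v ℕ.+ 1
            D = spread W ds

  deviationTotal-closed : ∀ W ds a c →
    deviationTotal W ds a c ≡ a * a * scoreSquareTotal W ds - + 2 * a * c * scoreTotal W ds + c * c * + κ′ ds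
  deviationTotal-closed W [] a c = base a c
    where base : ∀ a c → c * c ≡ a * a * 0ℤ - + 2 * a * c * 0ℤ + c * c * + 1
          base = solve-∀
  deviationTotal-closed W ((p , v) ∷ ds) a c = begin
    deviationTotal W ds a (c - a * + W v) + + (j ℕ.* v) * deviationTotal W ds a c
      ≡⟨ cong₂ (λ X Y → X + + (j ℕ.* v) * Y) (deviationTotal-closed W ds a (c - a * + W v)) (deviationTotal-closed W ds a c) ⟩
    _
      ≡⟨ step a c (+ W v) (+ (j ℕ.* v)) (scoreSquareTotal W ds) (scoreTotal W ds) (+ κ′ ds) ⟩
    _
      ≡⟨ cong (λ N → a * a * scoreSquareTotal W ((p , v) ∷ ds) - + 2 * a * c * scoreTotal W ((p , v) ∷ ds) + c * c * N)
              (+κ′-step p v ds) ⟨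
    _ ∎
    where
    open ≡-Reasoning
    step : ∀ a c w jv T S N →
      a * a * T - + 2 * a * (c - a * w) * S + (c - a * w) * (c - a * w) * N + jv * (a * a * T - + 2 * a * c * S + c * c * N)
      ≡ a * a * ((jv + 1ℤ) * T + + 2 * w * S + w * w * N) - + 2 * a * c * ((jv + 1ℤ) * S + w * N) + c * c * ((jv + 1ℤ) * N)
    step = solve-∀

  spread-closed : ∀ W ds → + κ′ ds * scoreSquareTotal W ds - scoreTotal W ds * scoreTotal W ds ≡ + spread W ds
  spread-closed W []             = refl
  spread-closed W ((p , v) ∷ ds) = begin
    + κ′ ((p , v) ∷ ds) * T′ - S′ * S′
      ≡⟨ cong (λ N′ → N′ * T′ - S′ * S′) (+κ′-step p v ds) ⟩
    (jv + 1ℤ) * N * ((jv + 1ℤ) * T + + 2 * w * S + w * w * N) - ((jv + 1ℤ) * S + w * N) * ((jv + 1ℤ) * S + w * N)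
      ≡⟨ step jv N T S w ⟩
    (jv + 1ℤ) * (jv + 1ℤ) * (N * T - S * S) + w * w * (N * N) * jv
      ≡⟨ cong (λ D → (jv + 1ℤ) * (jv + 1ℤ) * D + w * w * (N * N) * jv) (spread-closed W ds) ⟩
    (jv + 1ℤ) * (jv + 1ℤ) * + spread W ds + w * w * (N * N) * jv
      ≡⟨ +spread-step W p v ds ⟨
    + spread W ((p , v) ∷ ds) ∎
    where
    open ≡-Reasoning
    jv = + (j ℕ.* v)
    N = + κ′ ds
    T = scoreSquareTotal W ds
    S = scoreTotal W ds
    T′ = scoreSquareTotal W ((p , v) ∷ ds)
    S′ = scoreTotal W ((p , v) ∷ ds)
    w = + W v
    step : ∀ jv N T S w → (jv + 1ℤ) * N * ((jv + 1ℤ) * T + + 2 * w * S + w * w * N) - ((jv + 1ℤ) * S + w * N) * ((jv + 1ℤ) * S + w * N)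
                         ≡ (jv + 1ℤ) * (jv + 1ℤ) * (N * T - S * S) + w * w * (N * N) * jv
    step = solve-∀

  deviationTotal-at-mean : ∀ W ds → deviationTotal W ds (+ κ′ ds) (scoreTotal W ds) ≡ + κ′ ds * + spread W ds
  deviationTotal-at-mean W ds = begin
    deviationTotal W ds N S             ≡⟨ deviationTotal-closed W ds N S ⟩
    N * N * T - + 2 * N * S * S + S * S * N ≡⟨ factor N T S ⟩
    N * (N * T - S * S)                 ≡⟨ cong (N *_) (spread-closed W ds) ⟩
    N * + spread W ds                   ∎
    where
    open ≡-Reasoning
    N = + κ′ ds
    S = scoreTotal W ds
    T = scoreSquareTotal W ds
    factor : ∀ N T S → N * N * T - + 2 * N * S * S + S * S * N ≡ N * (N * T - S * S)
    factor = solve-∀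

  deviation : (E W : ℕ → ℕ) → PrimePowers → Vec ℕ j → ℤ
  deviation E W ds x = + κ′ ds * score E W ds x - scoreTotal W ds

  j*∑deviation²≤ : ∀ E W ds → Canonical ds → (∀ v → 1 ℕ.≤ v → E v ℕ.≤ j ℕ.* v) → (∀ v → W v ℕ.≤ 2 ℕ.* v) →
    (X : List (Vec ℕ j)) → Unique X → All (RegularTuple ⟦ ds ⟧ j) X →
    + j * ∑ (λ x → sq (deviation E W ds x)) X ≤ + κ′ ds * + (4 ℕ.* κ′ ds ℕ.* κ′ ds ℕ.* Ω′ ds)
  j*∑deviation²≤ E W ds can E≤jv W≤2v X X! X-reg = begin
    + j * ∑ (λ x → sq (deviation E W ds x)) X ≤⟨ *-monoˡ-≤-nonNeg (+ j) (∑sq-score≤deviationTotal E W ds can E≤jv X X! X-reg N S) ⟩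
    + j * deviationTotal W ds N S              ≡⟨ cong (+ j *_) (deviationTotal-at-mean W ds) ⟩
    + j * (N * + spread W ds)                  ≡⟨ swap (+ j) N (+ spread W ds) ⟩
    N * (+ j * + spread W ds)                  ≡⟨ cong (N *_) (pos-* j (spread W ds)) ⟨
    N * + (j ℕ.* spread W ds)                  ≤⟨ *-monoˡ-≤-nonNeg N (+≤+ (j*spread≤ W W≤2v ds)) ⟩
    N * + (4 ℕ.* κ′ ds ℕ.* κ′ ds ℕ.* Ω′ ds)    ∎
    where
    open ≤-Reasoning
    N = + κ′ ds
    S = scoreTotal W ds
    swap : ∀ a b c → a * (b * c) ≡ b * (a * c)
    swap = solve-∀

module Tests (j : ℕ) where

  open import Data.Nat
  open import Data.Nat.Properties
  open import Data.Nat.Divisibility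
  open import Data.Nat.LCM using (lcm; lcm-least; gcd*lcm)
  import Data.Nat.Coprimality as Coprime
  import Data.Fin.Properties as Fin
  open import Data.List.Properties using (length-map; length-++; length-tabulate)
  open import Data.Nat.Tactic.RingSolver using (solve-∀)

  -- At a prime with p ^ v ∥ n, the target code 0 says that p divides no entry of the viewed tuple,
  -- and the target i v + v of absorb i that p ^ v divides its i-th entry.
  data Test : Set where
    replace absorb : Fin j → Test
    keep           : Test

  view : Test → Vec ℕ j → ℕ → Vec ℕ j
  view (replace i) t h = t [ i ]≔ h
  view (absorb i)  t h = t [ i ]≔ (lookup t i * h)
  view keep        t h = t

  target : Test → ℕ → ℕ
  target (replace i) v = 0
  target (absorb i)  v = toℕ i * v + v
  target keep        v = 0

  weight : Test → ℕ → ℕ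
  weight (replace i) v = 2 * v
  weight (absorb i)  v = v
  weight keep        v = 2 * v

  tests : List Test
  tests = List.map replace (allFin j) ++ keep ∷ List.map absorb (allFin j)

  length-tests : length tests ≡ 2 * j + 1
  length-tests = begin
    length (List.map replace all ++ keep ∷ List.map absorb all)
      ≡⟨ length-++ (List.map replace all) ⟩
    length (List.map replace all) + suc (length (List.map absorb all))
      ≡⟨ cong₂ (λ a b → a + suc b) (length-map replace all) (length-map absorb all) ⟩
    length all + suc (length all)
      ≡⟨ cong (λ l → l + suc l) (length-tabulate {n = j} (λ i → i)) ⟩
    j + suc j
      ≡⟨ double j ⟩
    2 * j + 1 ∎
    where open ≡-Reasoning
          all = allFin j
          double : ∀ j → j + suc j ≡ 2 * j + 1
          double = solve-∀

  target≤j*v : ∀ τ v → 1 ≤ v → target τ v ≤ j * v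
  target≤j*v (replace i) v _ = z≤n
  target≤j*v (absorb i)  v _ = ≤-trans (≤-reflexive (+-comm (toℕ i * v) v)) (*-monoˡ-≤ v (Fin.toℕ<n i))
  target≤j*v keep        v _ = z≤n

  weight≤2*v : ∀ τ v → weight τ v ≤ 2 * v
  weight≤2*v (replace i) v = ≤-refl
  weight≤2*v (absorb i)  v = m≤n*m v 2
  weight≤2*v keep        v = ≤-refl

  CompatibleWith : ℕ → Vec ℕ j → ℕ → Set
  CompatibleWith n t h = RegularTuple n j t × h ∣ n × (∀ i → Coprime h (lookup t i))

  private
    coprime-* : ∀ {a b c} → Coprime a c → Coprime b c → Coprime (a * b) c
    coprime-* a⊥c b⊥c (d∣ab , d∣c) =
      b⊥c (Coprime.coprime-divisor (λ (e∣d , e∣a) → a⊥c (e∣a , ∣-trans e∣d d∣c)) d∣ab , d∣c)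

    coprime⇒*∣ : ∀ {a b n} → Coprime a b → a ∣ n → b ∣ n → a * b ∣ n
    coprime⇒*∣ {a} {b} a⊥b a∣n b∣n = subst (_∣ _) lcm≡* (lcm-least a∣n b∣n)
      where lcm≡* : lcm a b ≡ a * b
            lcm≡* = trans (sym (*-identityˡ (lcm a b)))
                          (trans (cong (_* lcm a b) (sym (Coprime.coprime⇒gcd≡1 a⊥b))) (gcd*lcm a b))

    update-regular : ∀ {n t} i y → RegularTuple n j t → y ∣ n → (∀ l → l ≢ i → Coprime y (lookup t l)) →
                     RegularTuple n j (t [ i ]≔ y)
    update-regular {n} {t} i y (t∣n , t-coprime) y∣n y-coprime = divides-n , coprime
      where
      divides-n : ∀ l → lookup (t [ i ]≔ y) l ∣ n
      divides-n l with l Fin.≟ i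
      ... | yes refl = subst (_∣ n) (sym (lookup∘update l t y)) y∣n
      ... | no l≢i   = subst (_∣ n) (sym (lookup∘update′ l≢i t y)) (t∣n l)
      coprime : ∀ a b → a ≢ b → Coprime (lookup (t [ i ]≔ y) a) (lookup (t [ i ]≔ y) b)
      coprime a b a≢b with a Fin.≟ i | b Fin.≟ i
      ... | yes refl | yes refl = ⊥-elim (a≢b refl)
      ... | yes refl | no b≢i rewrite lookup∘update a t y | lookup∘update′ b≢i t y = y-coprime b b≢i
      ... | no a≢i | yes refl rewrite lookup∘update′ a≢i t y | lookup∘update b t y = Coprime.sym (y-coprime a a≢i)
      ... | no a≢i | no b≢i rewrite lookup∘update′ a≢i t y | lookup∘update′ b≢i t y = t-coprime a b a≢b

  view-regular : ∀ {n t h} → CompatibleWith n t h → ∀ τ → RegularTuple n j (view τ t h)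
  view-regular {t = t} {h} (t-reg , h∣n , h⊥t) (replace i) = update-regular {t = t} i h t-reg h∣n (λ l _ → h⊥t l)
  view-regular {t = t} {h} (t-reg , h∣n , h⊥t) (absorb i)  =
    update-regular {t = t} i (lookup t i * h) t-reg (coprime⇒*∣ (Coprime.sym (h⊥t i)) (proj₁ t-reg i) h∣n)
                   (λ l l≢i → coprime-* (proj₂ t-reg i l (l≢i ∘ sym)) (h⊥t l))
  view-regular (t-reg , _ , _) keep = t-reg

  _≟ᵛ_ : DecidableEquality (Vec ℕ j)
  _≟ᵛ_ = ≡-dec _≟_

  module _ {n k : ℕ} {U : List (Vec ℕ j)} {g : Vec ℕ j → ℕ} (U-reg : RegularSet n j U) (g-reg : KRegular n j k U g) where

    private
      AtMost-mono : ∀ {P Q : ℕ → Set} → (∀ {z} → P z → Q z) → AtMost k Q → AtMost k P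
      AtMost-mono P⇒Q at-most zs zs! Pzs = at-most zs zs! (All.map P⇒Q Pzs)

      update-fibre≤k : ∀ (new : Vec ℕ j → ℕ) i κ → AtMost k (λ z → ((κ [ i ]≔ z) ∈ U) × (new (κ [ i ]≔ z) ≡ lookup κ i)) →
                       length (filter (λ t → (t [ i ]≔ new t) ≟ᵛ κ) U) ≤ k
      update-fibre≤k new i κ at-most =
        subst (_≤ k) (length-map (λ t → lookup t i) fibre) (at-most (List.map (λ t → lookup t i) fibre) entries! solutions)
        where
        fibre = filter (λ t → (t [ i ]≔ new t) ≟ᵛ κ) U
        in-fibre : ∀ {t} → t ∈ fibre → t ∈ U × (t [ i ]≔ new t) ≡ κ
        in-fibre = ∈-filter⁻ (λ t → (t [ i ]≔ new t) ≟ᵛ κ) {xs = U}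
        restore : ∀ {t} → t ∈ fibre → κ [ i ]≔ lookup t i ≡ t
        restore {t} t∈ = trans (cong (_[ i ]≔ lookup t i) (sym (proj₂ (in-fibre t∈))))
                               (trans ([]≔-idempotent t i) ([]≔-lookup t i))
        entries! : Unique (List.map (λ t → lookup t i) fibre)
        entries! = Unique-map⁺ (λ t → lookup t i)
                     (λ t∈ u∈ same → trans (sym (restore t∈)) (trans (cong (κ [ i ]≔_) same) (restore u∈)))
                     (Unique.filter⁺ _ (proj₁ U-reg))
        solutions : All (λ z → ((κ [ i ]≔ z) ∈ U) × (new (κ [ i ]≔ z) ≡ lookup κ i)) (List.map (λ t → lookup t i) fibre)
        solutions = All⁺.map⁺ (All.tabulate λ {t} t∈ →
          subst (_∈ U) (sym (restore t∈)) (proj₁ (in-fibre t∈)) ,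
          trans (cong new (restore t∈)) (trans (sym (lookup∘update i t (new t))) (cong (λ s → lookup s i) (proj₂ (in-fibre t∈)))))

    compatible : ∀ {t} → t ∈ U → CompatibleWith n t (g t)
    compatible {t} t∈U = All.lookup (proj₂ U-reg) t∈U , proj₁ g-reg t t∈U , proj₁ (proj₂ g-reg) t t∈U

    view-fibre≤k : 1 ≤ k → ∀ τ κ → length (filter (λ t → view τ t (g t) ≟ᵛ κ) U) ≤ k
    view-fibre≤k _   (replace i) κ = update-fibre≤k g i κ (proj₁ (proj₂ (proj₂ g-reg)) i κ (lookup κ i))
    view-fibre≤k _   (absorb i)  κ = update-fibre≤k (λ t → lookup t i * g t) i κ
      (AtMost-mono (λ {z} (∈U , eq) → ∈U , trans (sym (cong (_* g (κ [ i ]≔ z)) (lookup∘update i κ z))) eq)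
                   (proj₂ (proj₂ (proj₂ g-reg)) i κ (lookup κ i)))
    view-fibre≤k 1≤k keep        κ =
      ≤-trans (Unique-const⇒length≤1 _ (Unique.filter⁺ _ (proj₁ U-reg)) (All⁺.all-filter (_≟ᵛ κ) U)) 1≤k

module TestScores (j : ℕ) where

  open import Data.Nat as ℕ using (zero; suc)
  import Data.Nat.Properties as ℕ
  open import Data.Integer using (ℤ; +_; 0ℤ; 1ℤ; _+_; _*_; _-_; -_; _≤_; +≤+; nonNegative)
  open import Data.Integer.Properties
  open import Data.Integer.Tactic.RingSolver using (solve-∀)
  import Data.Nat.Tactic.RingSolver as ℕ-Solver
  open import Data.List.Properties using (length-tabulate)
  open Valuation
  open IntegerSums
  open PrimePowerLists
  open Counts j
  open Variance j
  open Tests j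

  hit : ℕ → ℕ → Vec ℕ j → ℕ → Test → ℤ
  hit p v t h τ = when (target τ v ℕ.≟ codeAt p v (view τ t h)) (+ weight τ v)

  testScore : ℕ → ℕ → Vec ℕ j → ℕ → ℤ
  testScore p v t h = ∑ (hit p v t h) tests

  totalDeviation : PrimePowers → Vec ℕ j → ℕ → ℤ
  totalDeviation ds t h = ∑ (λ τ → deviation (target τ) (weight τ) ds (view τ t h)) tests

  private
    deviation-step : ∀ E W p v ds x → deviation E W ((p , v) ∷ ds) x ≡
      + (j ℕ.* v ℕ.+ 1) * deviation E W ds x + + κ′ ds * (+ (j ℕ.* v ℕ.+ 1) * when (E v ℕ.≟ codeAt p v x) (+ W v) - + W v)
    deviation-step E W p v ds x =
      trans (cong (λ N′ → N′ * (when (E v ℕ.≟ codeAt p v x) (+ W v) + score E W ds x) - scoreTotal W ((p , v) ∷ ds))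
                  (pos-* (j ℕ.* v ℕ.+ 1) (κ′ ds)))
            (regroup (+ (j ℕ.* v ℕ.+ 1)) (+ κ′ ds) (when (E v ℕ.≟ codeAt p v x) (+ W v)) (score E W ds x) (scoreTotal W ds) (+ W v))
      where regroup : ∀ K N d F S w → K * N * (d + F) - (K * S + w * N) ≡ K * (N * F - S) + N * (K * d - w)
            regroup = solve-∀

    ∑-affine : ∀ {A : Set} (K N : ℤ) (f g w : A → ℤ) xs →
               ∑ (λ x → K * f x + N * (K * g x - w x)) xs ≡ K * ∑ f xs + N * (K * ∑ g xs - ∑ w xs)
    ∑-affine K N f g w []       = zeros K N
      where zeros : ∀ K N → 0ℤ ≡ K * 0ℤ + N * (K * 0ℤ - 0ℤ)
            zeros = solve-∀
    ∑-affine K N f g w (x ∷ xs) = trans (cong (λ s → K * f x + N * (K * g x - w x) + s) (∑-affine K N f g w xs))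
                                        (regroup K N (f x) (g x) (w x) (∑ f xs) (∑ g xs) (∑ w xs))
      where regroup : ∀ K N a b c A B C → K * a + N * (K * b - c) + (K * A + N * (K * B - C))
                                          ≡ K * (a + A) + N * (K * (b + B) - (c + C))
            regroup = solve-∀

  totalDeviation-step : ∀ p v ds t h → totalDeviation ((p , v) ∷ ds) t h ≡
    + (j ℕ.* v ℕ.+ 1) * totalDeviation ds t h + + κ′ ds * (+ (j ℕ.* v ℕ.+ 1) * testScore p v t h - ∑ (λ τ → + weight τ v) tests)
  totalDeviation-step p v ds t h =
    trans (∑-cong tests (λ {τ} _ → deviation-step (target τ) (weight τ) p v ds (view τ t h)))
          (∑-affine (+ (j ℕ.* v ℕ.+ 1)) (+ κ′ ds) _ (hit p v t h) (λ τ → + weight τ v) tests)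

  ∑-weights : ∀ v → ∑ (λ τ → + weight τ v) tests ≡ + ((3 ℕ.* j ℕ.+ 2) ℕ.* v)
  ∑-weights v = begin
    ∑ w (List.map replace all ++ keep ∷ List.map absorb all)
      ≡⟨ ∑-++ w (List.map replace all) (keep ∷ List.map absorb all) ⟩
    ∑ w (List.map replace all) + (+ (2 ℕ.* v) + ∑ w (List.map absorb all))
      ≡⟨ cong₂ (λ a b → a + (+ (2 ℕ.* v) + b)) (∑-over-all replace (+ (2 ℕ.* v)) (λ _ → refl)) (∑-over-all absorb (+ v) (λ _ → refl)) ⟩
    + j * + (2 ℕ.* v) + (+ (2 ℕ.* v) + + j * + v)
      ≡⟨ cong₂ (λ a b → a + (+ (2 ℕ.* v) + b)) (pos-* j (2 ℕ.* v)) (pos-* j v) ⟨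
    + (j ℕ.* (2 ℕ.* v) ℕ.+ (2 ℕ.* v ℕ.+ j ℕ.* v))
      ≡⟨ cong +_ (sum j v) ⟩
    + ((3 ℕ.* j ℕ.+ 2) ℕ.* v) ∎
    where
    open ≡-Reasoning
    all = allFin j
    w = λ τ → + weight τ v
    ∑-over-all : ∀ (τ : Fin j → Test) c → (∀ i → w (τ i) ≡ c) → ∑ w (List.map τ all) ≡ + j * c
    ∑-over-all τ c w≡c = begin
      ∑ w (List.map τ all)      ≡⟨ ∑-map w τ all ⟩
      ∑ (w ∘ τ) all             ≡⟨ ∑-cong all (λ {i} _ → w≡c i) ⟩
      ∑ (λ _ → c) all           ≡⟨ ∑-const c all ⟩
      + length all * c          ≡⟨ cong (λ l → + l * c) (length-tabulate {n = j} (λ i → i)) ⟩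
      + j * c                   ∎
    sum : ∀ j v → j ℕ.* (2 ℕ.* v) ℕ.+ (2 ℕ.* v ℕ.+ j ℕ.* v) ≡ (3 ℕ.* j ℕ.+ 2) ℕ.* v
    sum = ℕ-Solver.solve-∀

  ScoreBound : ℕ → ℤ → Set
  ScoreBound v s = + (2 ℕ.* v) ≤ s × (v ≡ 1 → + 3 ≤ s)

  private
    hit≥0 : ∀ p v t h τ → 0ℤ ≤ hit p v t h τ
    hit≥0 p v t h τ with target τ v ℕ.≟ codeAt p v (view τ t h)
    ... | yes _ = +≤+ ℕ.z≤n
    ... | no _  = ≤-refl

    hit-on-target : ∀ {p v t h} τ → codeAt p v (view τ t h) ≡ target τ v → hit p v t h τ ≡ + weight τ v
    hit-on-target {p} {v} {t} {h} τ code≡ with target τ v ℕ.≟ codeAt p v (view τ t h)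
    ... | yes _       = refl
    ... | no ≢target  = ⊥-elim (≢target (sym code≡))

    parts≤testScore : ∀ {p v t h a b c} → a ≤ ∑ (hit p v t h) (List.map replace (allFin j)) → b ≤ hit p v t h keep →
                      c ≤ ∑ (hit p v t h) (List.map absorb (allFin j)) → a + (b + c) ≤ testScore p v t h
    parts≤testScore {p} {v} {t} {h} a≤ b≤ c≤ =
      subst (_ ≤_) (sym (∑-++ (hit p v t h) (List.map replace (allFin j)) _)) (+-mono-≤ a≤ (+-mono-≤ b≤ c≤))

    hit≤∑ : ∀ {p v t h} (τ : Fin j → Test) i → hit p v t h (τ i) ≤ ∑ (hit p v t h) (List.map τ (allFin j))
    hit≤∑ {p} {v} {t} {h} τ i = term≤∑ (hit p v t h) _ (∈-map⁺ τ (∈-allFin i)) (hit≥0 p v t h)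

    update-all : ∀ {P : ℕ → Set} {y} (t : Vec ℕ j) i → P y → (∀ l → l ≢ i → P (lookup t l)) → ∀ l → P (lookup (t [ i ]≔ y) l)
    update-all {P} {y} t i Py Pt l with l Data.Fin.≟ i
    ... | yes refl = subst P (sym (lookup∘update l t y)) Py
    ... | no l≢i   = subst P (sym (lookup∘update′ l≢i t y)) (Pt l l≢i)

  module _ {n p v : ℕ} {t : Vec ℕ j} {h : ℕ} (1≤j : 1 ℕ.≤ j) (pp : Prime p) (n≢0 : n ≢ 0) (ord≡v : ord p n ≡ v)
           (compat : CompatibleWith n t h) where

    private
      p>1 : 1 ℕ.< p
      p>1 = prime⇒>1 pp

      t≢0 : ∀ l → lookup t l ≢ 0
      t≢0 l = ∣≢0 n≢0 (proj₁ (proj₁ compat) l)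

      h≢0 : h ≢ 0
      h≢0 = ∣≢0 n≢0 (proj₁ (proj₂ compat))

      ord≡1 : ∀ {x} → x ∣ n → p ∣ x → v ≡ 1 → ord p x ≡ 1
      ord≡1 {x} x∣n p∣x refl =
        ℕ.≤-antisym (subst (ord p x ℕ.≤_) ord≡v (ord-mono-∣ x n p>1 n≢0 x∣n)) (∣⇒ord>0 x p>1 (∣≢0 n≢0 x∣n) p∣x)

      code≡0 : ∀ (x : Vec ℕ j) → (∀ l → lookup x l ≢ 0) → (∀ l → p ∤ lookup x l) → codeAt p v x ≡ 0
      code≡0 x x≢0 p∤x = ExponentCodes.code-zeros v (map (ord p) x)
        (λ l → trans (lookup-map l (ord p) x) (ord≡0 (lookup x l) p>1 (x≢0 l) (p∤x l)))

      hit≤testScore : ∀ {τ} → τ ∈ tests → hit p v t h τ ≤ testScore p v t h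
      hit≤testScore τ∈ = term≤∑ (hit p v t h) tests τ∈ (hit≥0 p v t h)

      replace-hit : ∀ i → p ∤ h → (∀ l → l ≢ i → p ∤ lookup t l) → hit p v t h (replace i) ≡ + (2 ℕ.* v)
      replace-hit i p∤h p∤t = hit-on-target {p} {v} {t} {h} (replace i)
        (code≡0 (t [ i ]≔ h) (update-all {_≢ 0} t i h≢0 (λ l _ → t≢0 l)) (update-all {p ∤_} t i p∤h p∤t))

      keep-hit : (∀ l → p ∤ lookup t l) → hit p v t h keep ≡ + (2 ℕ.* v)
      keep-hit p∤t = hit-on-target {p} {v} {t} {h} keep (code≡0 t t≢0 p∤t)

      absorb-hit : ∀ i → v ≡ 1 → ord p (lookup t i ℕ.* h) ≡ 1 → (∀ l → l ≢ i → p ∤ lookup t l) → hit p v t h (absorb i) ≡ + 1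
      absorb-hit i refl ord≡1 p∤t = hit-on-target {p} {1} {t} {h} (absorb i)
        (ExponentCodes.code-single 1 (map (ord p) x) i 0
          (trans (lookup-map i (ord p) x) (trans (cong (ord p) (lookup∘update i t y)) ord≡1))
          (λ l l≢i → trans (lookup-map l (ord p) x) (trans (cong (ord p) (lookup∘update′ l≢i t y)) (ord≡0 _ p>1 (t≢0 l) (p∤t l l≢i)))))
        where y = lookup t i ℕ.* h
              x = t [ i ]≔ y

      i₀ : Fin j
      i₀ = Data.Fin.fromℕ< 1≤j

      replace∈tests : ∀ i → replace i ∈ tests
      replace∈tests i = ∈-++⁺ˡ (∈-map⁺ replace (∈-allFin i))

      keep∈tests : keep ∈ tests
      keep∈tests = ∈-++⁺ʳ (List.map replace (allFin j)) (here refl)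

    testScore-bound : ScoreBound v (testScore p v t h)
    testScore-bound with Data.Fin.Properties.any? (λ l → p ∣? lookup t l) | p ∣? h
    ... | yes (l , p∣tₗ) | _ =
      ≤-trans (≤-reflexive (sym (replace-hit l p∤h p∤others))) (hit≤testScore (replace∈tests l)) ,
      λ { refl → parts≤testScore (≤-trans (≤-reflexive (sym (replace-hit l p∤h p∤others))) (hit≤∑ replace l))
                                 (hit≥0 p v t h keep)
                                 (≤-trans (≤-reflexive (sym (absorb-hit l refl (ord-tₗh refl) p∤others))) (hit≤∑ absorb l)) }
      where
      p∤others : ∀ l′ → l′ ≢ l → p ∤ lookup t l′
      p∤others l′ l′≢l p∣ = prime∣coprime⇒⊥ pp (proj₂ (proj₁ compat) l′ l l′≢l) p∣ p∣tₗ
      p∤h : p ∤ h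
      p∤h p∣h = prime∣coprime⇒⊥ pp (proj₂ (proj₂ compat) l) p∣h p∣tₗ
      ord-tₗh : v ≡ 1 → ord p (lookup t l ℕ.* h) ≡ 1
      ord-tₗh v≡1 = trans (ord-* _ _ pp (t≢0 l) h≢0) (cong₂ ℕ._+_ (ord≡1 (proj₁ (proj₁ compat) l) p∣tₗ v≡1) (ord≡0 h p>1 h≢0 p∤h))
    ... | no p∤some | yes p∣h =
      ≤-trans (≤-reflexive (sym (keep-hit p∤t))) (hit≤testScore keep∈tests) ,
      λ { refl → parts≤testScore (∑-nonNeg (hit p v t h) (List.map replace (allFin j)) (hit≥0 p v t h))
                                 (≤-reflexive (sym (keep-hit p∤t)))
                                 (≤-trans (≤-reflexive (sym (absorb-hit i₀ refl (ord-t₀h refl) (λ l _ → p∤t l)))) (hit≤∑ absorb i₀)) }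
      where
      p∤t : ∀ l → p ∤ lookup t l
      p∤t l p∣tₗ = p∤some (l , p∣tₗ)
      ord-t₀h : v ≡ 1 → ord p (lookup t i₀ ℕ.* h) ≡ 1
      ord-t₀h v≡1 = trans (ord-* _ _ pp (t≢0 i₀) h≢0) (cong₂ ℕ._+_ (ord≡0 _ p>1 (t≢0 i₀) (p∤t i₀)) (ord≡1 (proj₁ (proj₂ compat)) p∣h v≡1))
    ... | no p∤some | no p∤h =
      ≤-trans (≤-reflexive (sym (keep-hit p∤t))) (hit≤testScore keep∈tests) ,
      λ { refl → ≤-trans (+≤+ (ℕ.s≤s (ℕ.s≤s (ℕ.s≤s ℕ.z≤n))))
                   (parts≤testScore (≤-trans (≤-reflexive (sym (replace-hit i₀ p∤h (λ l _ → p∤t l)))) (hit≤∑ replace i₀))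
                                    (≤-reflexive (sym (keep-hit p∤t)))
                                    (∑-nonNeg (hit p v t h) (List.map absorb (allFin j)) (hit≥0 p v t h))) }
      where
      p∤t : ∀ l → p ∤ lookup t l
      p∤t l p∣tₗ = p∤some (l , p∣tₗ)

  private
    minScore : ℕ → ℕ
    minScore 1 = 3
    minScore v = 2 ℕ.* v

    ScoreBound⇒minScore≤ : ∀ {v s} → 1 ℕ.≤ v → ScoreBound v s → + minScore v ≤ s
    ScoreBound⇒minScore≤ {suc zero}    _ (_ , 3≤s)  = 3≤s refl
    ScoreBound⇒minScore≤ {suc (suc v)} _ (2v≤s , _) = 2v≤s

    minScore-arith : ∀ j v → 1 ℕ.≤ j → 1 ℕ.≤ v →
      v ℕ.* (j ℕ.* v ℕ.+ 1) ℕ.+ (2 ℕ.* j ℕ.+ 1) ℕ.* ((3 ℕ.* j ℕ.+ 2) ℕ.* v)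
        ℕ.≤ (2 ℕ.* j ℕ.+ 1) ℕ.* ((j ℕ.* v ℕ.+ 1) ℕ.* minScore v)
    minScore-arith j (suc zero) _ _ = ℕ.≤-trans (ℕ.m≤m+n _ j) (ℕ.≤-reflexive (sym (slack j)))
      where slack : ∀ j → (2 ℕ.* j ℕ.+ 1) ℕ.* ((j ℕ.* 1 ℕ.+ 1) ℕ.* 3)
                          ≡ 1 ℕ.* (j ℕ.* 1 ℕ.+ 1) ℕ.+ (2 ℕ.* j ℕ.+ 1) ℕ.* ((3 ℕ.* j ℕ.+ 2) ℕ.* 1) ℕ.+ j
            slack = ℕ-Solver.solve-∀
    minScore-arith (suc j′) (suc (suc v′)) _ _ = ℕ.≤-trans (ℕ.m≤m+n _ _) (ℕ.≤-reflexive (sym (slack j′ v′)))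
      where slack : ∀ j′ v′ → let j = suc j′; v = 2 ℕ.+ v′ in
                      (2 ℕ.* j ℕ.+ 1) ℕ.* ((j ℕ.* v ℕ.+ 1) ℕ.* (2 ℕ.* v))
                      ≡ v ℕ.* (j ℕ.* v ℕ.+ 1) ℕ.+ (2 ℕ.* j ℕ.+ 1) ℕ.* ((3 ℕ.* j ℕ.+ 2) ℕ.* v)
                        ℕ.+ v ℕ.* (4 ℕ.* j ℕ.* j ℕ.* v′ ℕ.+ j ℕ.* v′ ℕ.+ 2 ℕ.* j′ ℕ.* j′ ℕ.+ 3 ℕ.* j′)
            slack = ℕ-Solver.solve-∀

  ScoreBound⇒deviation-gain : ∀ v s → 1 ℕ.≤ j → 1 ℕ.≤ v → ScoreBound v s →
    + (v ℕ.* (j ℕ.* v ℕ.+ 1)) ≤ + (2 ℕ.* j ℕ.+ 1) * (+ (j ℕ.* v ℕ.+ 1) * s - + ((3 ℕ.* j ℕ.+ 2) ℕ.* v))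
  ScoreBound⇒deviation-gain v s 1≤j 1≤v bound = begin
    + (v ℕ.* K)
      ≤⟨ x+y≤z⇒x≤z-y {y = + (M ℕ.* W)} (subst (_≤ + (M ℕ.* (K ℕ.* m))) (pos-+ (v ℕ.* K) (M ℕ.* W)) (+≤+ (minScore-arith j v 1≤j 1≤v))) ⟩
    + (M ℕ.* (K ℕ.* m)) - + (M ℕ.* W)
      ≡⟨ cong₂ _-_ (trans (pos-* M _) (cong (+ M *_) (pos-* K m))) (pos-* M W) ⟩
    + M * (+ K * + m) - + M * + W
      ≡⟨ factor (+ M) (+ K * + m) (+ W) ⟩
    + M * (+ K * + m - + W)
      ≤⟨ *-monoˡ-≤-nonNeg (+ M) (+-monoˡ-≤ (- + W) (*-monoˡ-≤-nonNeg (+ K) (ScoreBound⇒minScore≤ 1≤v bound))) ⟩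
    + M * (+ K * s - + W) ∎
    where
    open ≤-Reasoning
    K = j ℕ.* v ℕ.+ 1
    M = 2 ℕ.* j ℕ.+ 1
    W = (3 ℕ.* j ℕ.+ 2) ℕ.* v
    m = minScore v
    factor : ∀ a b c → a * b - a * c ≡ a * (b - c)
    factor = solve-∀
    x+y≤z⇒x≤z-y : ∀ {x y z} → x + y ≤ z → x ≤ z - y
    x+y≤z⇒x≤z-y {x} {y} x+y≤z = ≤-trans (≤-reflexive (cancel x y)) (+-monoˡ-≤ (- y) x+y≤z)
      where cancel : ∀ x y → x ≡ x + y - y
            cancel = solve-∀

  κ′*Ω′≤totalDeviation : ∀ {n t h} → 1 ℕ.≤ j → n ≢ 0 → CompatibleWith n t h → ∀ ds → ExactPowersOf n ds →
                         + (κ′ ds ℕ.* Ω′ ds) ≤ + (2 ℕ.* j ℕ.+ 1) * totalDeviation ds t h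
  κ′*Ω′≤totalDeviation {t = t} {h} 1≤j n≢0 compat [] [] = begin
    0ℤ                             ≡⟨ *-zeroʳ M ⟨
    M * 0ℤ                         ≡⟨ cong (M *_) (∑-zero tests) ⟨
    M * totalDeviation [] t h      ∎
    where open ≤-Reasoning
          M = + (2 ℕ.* j ℕ.+ 1)
  κ′*Ω′≤totalDeviation {t = t} {h} 1≤j n≢0 compat ((p , v) ∷ ds) ((pp , 1≤v , ord≡v) ∷ exact) = begin
    + (κ′ ((p , v) ∷ ds) ℕ.* Ω′ ((p , v) ∷ ds))
      ≡⟨ cast ⟩
    K * + (κ′ ds ℕ.* Ω′ ds) + N * + (v ℕ.* (j ℕ.* v ℕ.+ 1))
      ≤⟨ +-mono-≤ (*-monoˡ-≤-nonNeg K (κ′*Ω′≤totalDeviation 1≤j n≢0 compat ds exact))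
                  (*-monoˡ-≤-nonNeg N (ScoreBound⇒deviation-gain v s 1≤j 1≤v (testScore-bound 1≤j pp n≢0 ord≡v compat))) ⟩
    K * (M * totalDeviation ds t h) + N * (M * (K * s - Wsum))
      ≡⟨ factor K N M (totalDeviation ds t h) (K * s - Wsum) ⟩
    M * (K * totalDeviation ds t h + N * (K * s - Wsum))
      ≡⟨ cong (M *_) step ⟨
    M * totalDeviation ((p , v) ∷ ds) t h ∎
    where
    open ≤-Reasoning
    K = + (j ℕ.* v ℕ.+ 1)
    N = + κ′ ds
    M = + (2 ℕ.* j ℕ.+ 1)
    s = testScore p v t h
    Wsum = + ((3 ℕ.* j ℕ.+ 2) ℕ.* v)
    step : totalDeviation ((p , v) ∷ ds) t h ≡ K * totalDeviation ds t h + N * (K * s - Wsum)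
    step = trans (totalDeviation-step p v ds t h) (cong (λ w → K * totalDeviation ds t h + N * (K * s - w)) (∑-weights v))
    factor : ∀ K N M T D → K * (M * T) + N * (M * D) ≡ M * (K * T + N * D)
    factor = solve-∀
    cast : + (κ′ ((p , v) ∷ ds) ℕ.* Ω′ ((p , v) ∷ ds)) ≡ K * + (κ′ ds ℕ.* Ω′ ds) + N * + (v ℕ.* (j ℕ.* v ℕ.+ 1))
    cast = trans (cong +_ (expand (j ℕ.* v ℕ.+ 1) (κ′ ds) v (Ω′ ds)))
                 (trans (pos-+ ((j ℕ.* v ℕ.+ 1) ℕ.* (κ′ ds ℕ.* Ω′ ds)) _) (cong₂ _+_ (pos-* (j ℕ.* v ℕ.+ 1) _) (pos-* (κ′ ds) _)))
      where expand : ∀ k N v ω → k ℕ.* N ℕ.* (v ℕ.+ ω) ≡ k ℕ.* (N ℕ.* ω) ℕ.+ N ℕ.* (v ℕ.* k)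
            expand = ℕ-Solver.solve-∀

module SecondMoment (j : ℕ) where

  open import Data.Nat as ℕ using (zero; suc)
  import Data.Nat.Properties as ℕ
  open import Data.Integer using (ℤ; +_; 0ℤ; _+_; _*_; _≤_; +≤+; nonNegative)
  open import Data.Integer.Properties
  open import Data.Integer.Tactic.RingSolver using (solve-∀)
  import Data.Nat.Tactic.RingSolver as ℕ-Solver
  open IntegerSums
  open PrimePowerLists
  open Counts j
  open Variance j
  open Tests j
  open TestScores j

  module _ {n k : ℕ} {U : List (Vec ℕ j)} {g : Vec ℕ j → ℕ} (U-reg : RegularSet n j U) (g-reg : KRegular n j k U g)
           (1≤k : 1 ℕ.≤ k) {ds : PrimePowers} (can : Canonical ds) (⟦ds⟧≡n : ⟦ ds ⟧ ≡ n) where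

    j*∑deviation²≤-per-test : ∀ τ →
      + j * ∑ (λ t → sq (deviation (target τ) (weight τ) ds (view τ t (g t)))) U
        ≤ + k * (+ κ′ ds * + (4 ℕ.* κ′ ds ℕ.* κ′ ds ℕ.* Ω′ ds))
    j*∑deviation²≤-per-test τ = begin
      + j * ∑ (φ ∘ viewed) U          ≤⟨ *-monoˡ-≤-nonNeg (+ j) (∑-fibres-≤ _≟ᵛ_ viewed φ U k (0≤sq ∘ deviation (target τ) (weight τ) ds)
                                                                           (view-fibre≤k U-reg g-reg 1≤k τ)) ⟩
      + j * (+ k * ∑ φ images)        ≡⟨ swap (+ j) (+ k) (∑ φ images) ⟩
      + k * (+ j * ∑ φ images)        ≤⟨ *-monoˡ-≤-nonNeg (+ k) (j*∑deviation²≤ (target τ) (weight τ) ds can (target≤j*v τ) (weight≤2*v τ)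
                                                                   images (deduplicate-! _≟ᵛ_ _) images-regular) ⟩
      + k * (+ κ′ ds * + (4 ℕ.* κ′ ds ℕ.* κ′ ds ℕ.* Ω′ ds)) ∎
      where
      open ≤-Reasoning
      viewed = λ t → view τ t (g t)
      φ = λ x → sq (deviation (target τ) (weight τ) ds x)
      images = deduplicate _≟ᵛ_ (List.map viewed U)
      images-regular : All (RegularTuple ⟦ ds ⟧ j) images
      images-regular = All.tabulate λ x∈ →
        let t , t∈U , x≡ = ∈-map⁻ viewed (∈-deduplicate⁻ _≟ᵛ_ (List.map viewed U) x∈)
        in subst₂ (λ m x → RegularTuple m j x) (sym ⟦ds⟧≡n) (sym x≡) (view-regular (compatible U-reg g-reg t∈U) τ)
      swap : ∀ a b c → a * (b * c) ≡ b * (a * c)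
      swap = solve-∀

    private
      m : ℕ
      m = 2 ℕ.* j ℕ.+ 1

      M : ℤ
      M = + m

      B : ℤ
      B = + k * (+ κ′ ds * + (4 ℕ.* κ′ ds ℕ.* κ′ ds ℕ.* Ω′ ds))

      deviations² : Vec ℕ j → ℤ
      deviations² t = ∑ (λ τ → sq (deviation (target τ) (weight τ) ds (view τ t (g t)))) tests

      +length-tests : + length tests ≡ M
      +length-tests = cong +_ length-tests

    j*∑deviations²≤ : + j * ∑ deviations² U ≤ M * B
    j*∑deviations²≤ = begin
      + j * ∑ deviations² U                         ≡⟨ cong (+ j *_) (∑-swap _ tests U) ⟩
      + j * ∑ (λ τ → ∑ (dev² τ) U) tests            ≡⟨ ∑-*ˡ (+ j) _ tests ⟨
      ∑ (λ τ → + j * ∑ (dev² τ) U) tests            ≤⟨ ∑-mono-≤ tests (λ {τ} _ → j*∑deviation²≤-per-test τ) ⟩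
      ∑ (λ _ → B) tests                             ≡⟨ ∑-const B tests ⟩
      + length tests * B                            ≡⟨ cong (_* B) +length-tests ⟩
      M * B                                         ∎
      where
      open ≤-Reasoning
      dev² = λ τ t → sq (deviation (target τ) (weight τ) ds (view τ t (g t)))

    j*length*[κ′*Ω′]²≤ : 1 ℕ.≤ j → + j * (+ length U * sq (+ (κ′ ds ℕ.* Ω′ ds))) ≤ M * M * M * (M * B)
    j*length*[κ′*Ω′]²≤ 1≤j = begin
      + j * (+ length U * sq T)             ≡⟨ cong (+ j *_) (∑-const (sq T) U) ⟨
      + j * ∑ (λ _ → sq T) U                ≤⟨ *-monoˡ-≤-nonNeg (+ j) (∑-mono-≤ U T²≤) ⟩
      + j * ∑ (λ t → M * M * M * deviations² t) U ≡⟨ cong (+ j *_) (∑-*ˡ (M * M * M) deviations² U) ⟩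
      + j * (M * M * M * ∑ deviations² U)  ≡⟨ swap (+ j) (M * M * M) (∑ deviations² U) ⟩
      M * M * M * (+ j * ∑ deviations² U)  ≤⟨ *-monoˡ-≤-nonNeg (M * M * M) {{nonNegative 0≤M³}} j*∑deviations²≤ ⟩
      M * M * M * (M * B)                   ∎
      where
      open ≤-Reasoning
      T = + (κ′ ds ℕ.* Ω′ ds)
      n≢0 : n ≢ 0
      n≢0 = subst (_≢ 0) ⟦ds⟧≡n (⟦⟧≢0 ds can)
      exact : ExactPowersOf n ds
      exact = subst (λ m → ExactPowersOf m ds) ⟦ds⟧≡n (canonical⇒exact ds can)
      T²≤ : ∀ {t} → t ∈ U → sq T ≤ M * M * M * deviations² t
      T²≤ {t} t∈U = subst (λ m → sq T ≤ m * m * m * deviations² t) +length-tests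
        (sq≤cube*∑sq (λ τ → deviation (target τ) (weight τ) ds (view τ t (g t))) tests T
          (subst (0 ℕ.<_) (sym length-tests) (ℕ.m≤n+m 1 (2 ℕ.* j))) (+≤+ ℕ.z≤n)
          (subst (λ m → T ≤ m * totalDeviation ds t (g t)) (sym +length-tests)
            (κ′*Ω′≤totalDeviation 1≤j n≢0 (compatible U-reg g-reg t∈U) ds exact)))
      0≤M³ : 0ℤ ≤ M * M * M
      0≤M³ = subst (0ℤ ≤_) (trans (pos-* (m ℕ.* m) m) (cong (_* M) (pos-* m m))) (+≤+ ℕ.z≤n)
      swap : ∀ a b c → a * (b * c) ≡ b * (a * c)
      swap = solve-∀

    private
      j*length*[κ′*Ω′]²≤ℕ : 1 ℕ.≤ j → let N = κ′ ds; ω = Ω′ ds in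
        j ℕ.* (length U ℕ.* ((N ℕ.* ω) ℕ.* (N ℕ.* ω))) ℕ.≤ m ℕ.* m ℕ.* m ℕ.* (m ℕ.* (k ℕ.* (N ℕ.* (4 ℕ.* N ℕ.* N ℕ.* ω))))
      j*length*[κ′*Ω′]²≤ℕ 1≤j = drop‿+≤+ (subst₂ _≤_ cast-lhs cast-rhs (j*length*[κ′*Ω′]²≤ 1≤j))
        where
        N = κ′ ds
        x = N ℕ.* Ω′ ds
        u = length U
        cast-lhs : + j * (+ u * sq (+ x)) ≡ + (j ℕ.* (u ℕ.* (x ℕ.* x)))
        cast-lhs = sym (trans (pos-* j _) (cong (+ j *_) (trans (pos-* u _) (cong (+ u *_) (pos-* x x)))))
        cast-rhs : M * M * M * (M * B) ≡ + (m ℕ.* m ℕ.* m ℕ.* (m ℕ.* (k ℕ.* (N ℕ.* (4 ℕ.* N ℕ.* N ℕ.* Ω′ ds)))))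
        cast-rhs = sym (trans (pos-* (m ℕ.* m ℕ.* m) _)
                     (cong₂ _*_ (trans (pos-* (m ℕ.* m) m) (cong (_* M) (pos-* m m)))
                                (trans (pos-* m _) (cong (M *_) (trans (pos-* k _) (cong (+ k *_) (pos-* N _)))))))

    length*Ω′≤ : 1 ℕ.≤ j → 1 ℕ.≤ Ω′ ds → length U ℕ.* Ω′ ds ℕ.≤ 4 ℕ.* m ℕ.* m ℕ.* m ℕ.* m ℕ.* k ℕ.* κ′ ds
    length*Ω′≤ 1≤j 1≤Ω = begin
      length U ℕ.* ω                    ≤⟨ ℕ.m≤n*m _ j {{ℕ.>-nonZero 1≤j}} ⟩
      j ℕ.* (length U ℕ.* ω)            ≤⟨ ℕ.*-cancelʳ-≤ _ _ (N ℕ.* N ℕ.* ω) {{NNω≢0}} multiplied ⟩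
      4 ℕ.* m ℕ.* m ℕ.* m ℕ.* m ℕ.* k ℕ.* N ∎
      where
      open ℕ.≤-Reasoning
      N = κ′ ds
      ω = Ω′ ds
      NNω≢0 : ℕ.NonZero (N ℕ.* N ℕ.* ω)
      NNω≢0 = ℕ.≢-nonZero (Valuation.*≢0 (Valuation.*≢0 (κ′≢0 ds) (κ′≢0 ds)) (ℕ.m<n⇒n≢0 1≤Ω))
      lhs : ∀ j u N ω → j ℕ.* (u ℕ.* ((N ℕ.* ω) ℕ.* (N ℕ.* ω))) ≡ (j ℕ.* (u ℕ.* ω)) ℕ.* (N ℕ.* N ℕ.* ω)
      lhs = ℕ-Solver.solve-∀
      rhs : ∀ m k N ω → m ℕ.* m ℕ.* m ℕ.* (m ℕ.* (k ℕ.* (N ℕ.* (4 ℕ.* N ℕ.* N ℕ.* ω))))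
                        ≡ (4 ℕ.* m ℕ.* m ℕ.* m ℕ.* m ℕ.* k ℕ.* N) ℕ.* (N ℕ.* N ℕ.* ω)
      rhs = ℕ-Solver.solve-∀
      multiplied : j ℕ.* (length U ℕ.* ω) ℕ.* (N ℕ.* N ℕ.* ω) ℕ.≤ 4 ℕ.* m ℕ.* m ℕ.* m ℕ.* m ℕ.* k ℕ.* N ℕ.* (N ℕ.* N ℕ.* ω)
      multiplied = subst₂ ℕ._≤_ (lhs j (length U) N ω) (rhs m k N ω) (j*length*[κ′*Ω′]²≤ℕ 1≤j)

module CanonicalFactorisation where

  open import Data.Nat
  open import Data.Nat.Properties
  open import Data.Nat.ListAction using (sum; product)
  open import Data.List.Properties using (filter-accept; filter-reject; map-cong)
  open import Data.Nat.Tactic.RingSolver using (solve-∀)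
  open PrimePowerLists

  count : ℕ → List ℕ → ℕ
  count p xs = length (filter (_≟ p) xs)

  𝟙[_≟_] : ℕ → ℕ → ℕ
  𝟙[ x ≟ p ] with x ≟ p
  ... | yes _ = 1
  ... | no _  = 0

  count-∷ : ∀ p x xs → count p (x ∷ xs) ≡ 𝟙[ x ≟ p ] + count p xs
  count-∷ p x xs with x ≟ p
  ... | yes x≡p = cong length (filter-accept (_≟ p) x≡p)
  ... | no x≢p  = cong length (filter-reject (_≟ p) x≢p)

  module _ {x : ℕ} where

    ∑𝟙-∉ : ∀ qs → x ∉ qs → sum (List.map (λ q → 𝟙[ x ≟ q ]) qs) ≡ 0
    ∑𝟙-∉ []       _  = refl
    ∑𝟙-∉ (q ∷ qs) x∉ with x ≟ q
    ... | yes x≡q = ⊥-elim (x∉ (here x≡q))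
    ... | no _    = ∑𝟙-∉ qs (x∉ ∘ there)

    ∑𝟙-∈ : ∀ qs → Unique qs → x ∈ qs → sum (List.map (λ q → 𝟙[ x ≟ q ]) qs) ≡ 1
    ∑𝟙-∈ (q ∷ qs) (q∉qs ∷ qs!) x∈ with x ≟ q | x∈
    ... | yes refl | _         = cong suc (∑𝟙-∉ qs (All¬⇒¬Any q∉qs))
    ... | no x≢q   | here x≡q  = ⊥-elim (x≢q x≡q)
    ... | no _     | there x∈′ = ∑𝟙-∈ qs qs! x∈′

    ∏^𝟙-∉ : ∀ qs → x ∉ qs → product (List.map (λ q → q ^ 𝟙[ x ≟ q ]) qs) ≡ 1
    ∏^𝟙-∉ []       _  = refl
    ∏^𝟙-∉ (q ∷ qs) x∉ with x ≟ q
    ... | yes x≡q = ⊥-elim (x∉ (here x≡q))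
    ... | no _    = trans (+-identityʳ _) (∏^𝟙-∉ qs (x∉ ∘ there))

    ∏^𝟙-∈ : ∀ qs → Unique qs → x ∈ qs → product (List.map (λ q → q ^ 𝟙[ x ≟ q ]) qs) ≡ x
    ∏^𝟙-∈ (q ∷ qs) (q∉qs ∷ qs!) x∈ with x ≟ q | x∈
    ... | yes refl | _         = trans (cong (x ^ 1 *_) (∏^𝟙-∉ qs (All¬⇒¬Any q∉qs))) (trans (*-identityʳ _) (*-identityʳ x))
    ... | no x≢q   | here x≡q  = ⊥-elim (x≢q x≡q)
    ... | no _     | there x∈′ = trans (+-identityʳ _) (∏^𝟙-∈ qs qs! x∈′)

  private
    sum-map-+ : ∀ (f g : ℕ → ℕ) qs → sum (List.map (λ q → f q + g q) qs) ≡ sum (List.map f qs) + sum (List.map g qs)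
    sum-map-+ f g []       = refl
    sum-map-+ f g (q ∷ qs) rewrite sum-map-+ f g qs = swap (f q) (g q) (sum (List.map f qs)) (sum (List.map g qs))
      where swap : ∀ a b c d → a + b + (c + d) ≡ a + c + (b + d)
            swap = solve-∀

    product-map-* : ∀ (f g : ℕ → ℕ) qs → product (List.map (λ q → f q * g q) qs) ≡ product (List.map f qs) * product (List.map g qs)
    product-map-* f g []       = refl
    product-map-* f g (q ∷ qs) rewrite product-map-* f g qs = swap (f q) (g q) (product (List.map f qs)) (product (List.map g qs))
      where swap : ∀ a b c d → a * b * (c * d) ≡ a * c * (b * d)
            swap = solve-∀

  module _ {qs : List ℕ} (qs! : Unique qs) where

    ∑count≡length : ∀ xs → (∀ {x} → x ∈ xs → x ∈ qs) → sum (List.map (λ q → count q xs) qs) ≡ length xs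
    ∑count≡length []       _     = sum-zeros qs
      where sum-zeros : ∀ qs → sum (List.map (λ q → count q []) qs) ≡ 0
            sum-zeros []       = refl
            sum-zeros (_ ∷ qs) = sum-zeros qs
    ∑count≡length (x ∷ xs) ⊆qs = begin
      sum (List.map (λ q → count q (x ∷ xs)) qs)
        ≡⟨ cong sum (map-cong (λ q → count-∷ q x xs) qs) ⟩
      sum (List.map (λ q → 𝟙[ x ≟ q ] + count q xs) qs)
        ≡⟨ sum-map-+ _ _ qs ⟩
      sum (List.map (λ q → 𝟙[ x ≟ q ]) qs) + sum (List.map (λ q → count q xs) qs)
        ≡⟨ cong₂ _+_ (∑𝟙-∈ qs qs! (⊆qs (here refl))) (∑count≡length xs (⊆qs ∘ there)) ⟩
      suc (length xs) ∎
      where open ≡-Reasoning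

    ∏^count≡product : ∀ xs → (∀ {x} → x ∈ xs → x ∈ qs) → product (List.map (λ q → q ^ count q xs) qs) ≡ product xs
    ∏^count≡product []       _     = product-ones qs
      where product-ones : ∀ qs → product (List.map (λ q → q ^ count q []) qs) ≡ 1
            product-ones []       = refl
            product-ones (_ ∷ qs) = trans (+-identityʳ _) (product-ones qs)
    ∏^count≡product (x ∷ xs) ⊆qs = begin
      product (List.map (λ q → q ^ count q (x ∷ xs)) qs)
        ≡⟨ cong product (map-cong (λ q → trans (cong (q ^_) (count-∷ q x xs)) (^-distribˡ-+-* q 𝟙[ x ≟ q ] (count q xs))) qs) ⟩
      product (List.map (λ q → q ^ 𝟙[ x ≟ q ] * q ^ count q xs) qs)
        ≡⟨ product-map-* _ _ qs ⟩
      product (List.map (λ q → q ^ 𝟙[ x ≟ q ]) qs) * product (List.map (λ q → q ^ count q xs) qs)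
        ≡⟨ cong₂ _*_ (∏^𝟙-∈ qs qs! (⊆qs (here refl))) (∏^count≡product xs (⊆qs ∘ there)) ⟩
      x * product xs ∎
      where open ≡-Reasoning

  primePowersOf : ℕ → PrimePowers
  primePowersOf n = List.map (λ p → p , val p n) (deduplicate _≟_ (primeFactors n))

  private
    pairs : ℕ → List ℕ → PrimePowers
    pairs n = List.map (λ p → p , val p n)

    ⟦pairs⟧ : ∀ n ps → ⟦ pairs n ps ⟧ ≡ product (List.map (λ p → p ^ val p n) ps)
    ⟦pairs⟧ n []       = refl
    ⟦pairs⟧ n (p ∷ ps) = cong (p ^ val p n *_) (⟦pairs⟧ n ps)

    Ω′-pairs : ∀ n ps → Ω′ (pairs n ps) ≡ sum (List.map (λ p → val p n) ps)
    Ω′-pairs n []       = refl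
    Ω′-pairs n (p ∷ ps) = cong (val p n +_) (Ω′-pairs n ps)

    primes! : ∀ n → Unique (deduplicate _≟_ (primeFactors n))
    primes! n = deduplicate-! _≟_ (primeFactors n)

    ∈-primes⁺ : ∀ {n p} → p ∈ primeFactors n → p ∈ deduplicate _≟_ (primeFactors n)
    ∈-primes⁺ = ∈-deduplicate⁺ _≟_

  ⟦primePowersOf⟧ : ∀ n → n ≢ 0 → ⟦ primePowersOf n ⟧ ≡ n
  ⟦primePowersOf⟧ zero    n≢0 = ⊥-elim (n≢0 refl)
  ⟦primePowersOf⟧ (suc m) _   = begin
    ⟦ primePowersOf (suc m) ⟧                                         ≡⟨ ⟦pairs⟧ (suc m) (deduplicate _≟_ L) ⟩
    product (List.map (λ p → p ^ val p (suc m)) (deduplicate _≟_ L))  ≡⟨ ∏^count≡product (primes! (suc m)) L (∈-primes⁺ {suc m}) ⟩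
    product L                                                         ≡⟨ PrimeFactorisation.isFactorisation (factorise (suc m)) ⟨
    suc m                                                             ∎
    where open ≡-Reasoning
          L : List ℕ
          L = primeFactors (suc m)

  Ω′-primePowersOf : ∀ n → Ω′ (primePowersOf n) ≡ Ω n
  Ω′-primePowersOf n =
    trans (Ω′-pairs n (deduplicate _≟_ (primeFactors n))) (∑count≡length (primes! n) (primeFactors n) (∈-primes⁺ {n}))

  canonical-primePowersOf : ∀ n → Canonical (primePowersOf n)
  canonical-primePowersOf zero    = tt
  canonical-primePowersOf (suc m) = go (deduplicate _≟_ L) (primes! (suc m)) (∈-deduplicate⁻ _≟_ L)
    where
    L : List ℕ
    L = primeFactors (suc m)
    go : ∀ ps → Unique ps → (∀ {p} → p ∈ ps → p ∈ L) → Canonical (pairs (suc m) ps)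
    go []       _            _   = _
    go (p ∷ ps) (p∉ps ∷ ps!) ⊆L =
      All.lookup (PrimeFactorisation.factorsPrime (factorise (suc m))) (⊆L (here refl)) ,
      count≥1 L (⊆L (here refl)) ,
      All⁺.map⁺ (All.map (λ p≢q q≡p → p≢q (sym q≡p)) p∉ps) ,
      go ps ps! (⊆L ∘ there)
      where
      count≥1 : ∀ xs → p ∈ xs → 1 ≤ count p xs
      count≥1 (x ∷ xs) x∈ rewrite count-∷ p x xs with x ≟ p | x∈
      ... | yes _   | _          = s≤s z≤n
      ... | no x≢p  | here p≡x   = ⊥-elim (x≢p (sym p≡x))
      ... | no _    | there p∈xs = count≥1 xs p∈xs

  1≤Ω : ∀ n → 2 ≤ n → 1 ≤ Ω n
  1≤Ω (suc m) 2≤n with primeFactors (suc m) | PrimeFactorisation.isFactorisation (factorise (suc m))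
  ... | []    | n≡1 = ⊥-elim (<⇒≢ 2≤n (sym n≡1))
  ... | _ ∷ _ | _   = s≤s z≤n

  κ′-primePowersOf : ∀ j n → Counts.κ′ j (primePowersOf n) ≡ κ j n
  κ′-primePowersOf j n = go (deduplicate _≟_ (primeFactors n))
    where go : ∀ ps → Counts.κ′ j (pairs n ps) ≡ product (List.map (λ p → j * val p n + 1) ps)
          go []       = refl
          go (p ∷ ps) = cong ((j * val p n + 1) *_) (go ps)

open import Data.Nat using (_+_; _*_; _≤_)
open import Data.Nat.Properties using (m<n⇒n≢0)

corollary2 : (j : ℕ) → 1 ≤ j →
    Σ ℕ (λ C → (k n : ℕ) → 1 ≤ k → 2 ≤ n →
      (U : List (Tuple j)) → RegularSet n j U →
      (g : Tuple j → ℕ) → KRegular n j k U g →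
      length U * Ω n ≤ C * k * κ j n)
corollary2 j 1≤j = 4 * m * m * m * m , bound
  where
  open PrimePowerLists
  open CanonicalFactorisation
  m = 2 * j + 1
  bound : (k n : ℕ) → 1 ≤ k → 2 ≤ n → (U : List (Tuple j)) → RegularSet n j U → (g : Tuple j → ℕ) → KRegular n j k U g →
          length U * Ω n ≤ 4 * m * m * m * m * k * κ j n
  bound k n 1≤k 2≤n U U-reg g g-reg =
    subst₂ (λ ω κ′ → length U * ω ≤ 4 * m * m * m * m * k * κ′) (Ω′-primePowersOf n) (κ′-primePowersOf j n)
      (SecondMoment.length*Ω′≤ j U-reg g-reg 1≤k (canonical-primePowersOf n) (⟦primePowersOf⟧ n (m<n⇒n≢0 2≤n)) 1≤j 1≤Ω′)
    where
    1≤Ω′ : 1 ≤ Ω′ (primePowersOf n)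
    1≤Ω′ = subst (1 ≤_) (sym (Ω′-primePowersOf n)) (1≤Ω n 2≤n)
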